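{- Let $n\ge 5$ be an integer. If a signed circular ladder $CL_n$ is flow-admissible, then it has a nowhere-zero $5$-flow.
   Context: The circular ladder $CL_n$ (of order $2n$) has vertices $v_1,\dots,v_n,u_1,\dots,u_n$ and edges $v_jv_{j+1}$, $u_ju_{j+1}$ (indices modulo $n$) and rungs $v_ju_j$; a signed circular ladder carries a sign $+$ or $-$ on each edge. An orientation of a signed graph splits each edge into two half-edges; a positive edge has one half-edge directed away from and one towards its end-vertex, a negative edge has both half-edges directed towards, or both away from, their end-vertices. A nowhere-zero $k$-flow is an orientation with values from $\{\pm1,\dots,\pm(k-1)\}$ on the edges such that at every vertex the sum of incoming values equals the sum of outgoing values. A signed graph is flow-admissible if it admits a nowhere-zero $k$-flow for some $k$. -}

module Defs where

open import Data.Nat as ℕ using (ℕ; suc)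
open import Data.Nat.DivMod using (_%_; m%n<n)
open import Data.Fin as Fin using (Fin; toℕ; fromℕ<)
open import Data.Fin.Properties using () renaming (_≟_ to _≟F_)
open import Data.Integer as ℤ using (ℤ; 0ℤ; ∣_∣)
open import Data.Bool using (Bool; true; false; _∧_; if_then_else_)
open import Data.List using (List; []; _∷_; foldr; map; concatMap; allFin)
open import Data.Product using (Σ; ∃; _×_; _,_)
open import Data.Product.Properties using (≡-dec)
open import Relation.Binary.PropositionalEquality using (_≡_; _≢_; refl)
open import Relation.Binary.Definitions using (DecidableEquality)
open import Relation.Nullary using (yes; no; does)

-- The circular ladder CL_n
-- vertices v_1..v_n (side vS) and u_1..u_n (side uS), indices in Fin n

data Side : Set where
  vS uS : Side

_≟S_ : DecidableEquality Side
vS ≟S vS = yes refl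
vS ≟S uS = no (λ ())
uS ≟S vS = no (λ ())
uS ≟S uS = yes refl

Vertex : ℕ → Set
Vertex n = Side × Fin n

_≟V_ : ∀ {n} → DecidableEquality (Vertex n)
_≟V_ = ≡-dec _≟S_ _≟F_

-- edge kinds: v_j v_{j+1}, u_j u_{j+1}, rung v_j u_j
data EdgeKind : Set where
  vv uu rung : EdgeKind

Edge : ℕ → Set
Edge n = EdgeKind × Fin n

next : ∀ {n} → Fin n → Fin n
next {suc m} i = fromℕ< (m%n<n (suc (toℕ i)) (suc m))

data End : Set where
  end₁ end₂ : End

endpoint : ∀ {n} → Edge n → End → Vertex n
endpoint (vv   , j) end₁ = vS , j
endpoint (vv   , j) end₂ = vS , next j
endpoint (uu   , j) end₁ = uS , j
endpoint (uu   , j) end₂ = uS , next j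
endpoint (rung , j) end₁ = vS , j
endpoint (rung , j) end₂ = uS , j

allEdges : (n : ℕ) → List (Edge n)
allEdges n = concatMap (λ κ → map (λ j → κ , j) (allFin n)) (vv ∷ uu ∷ rung ∷ [])

halfEdges : (n : ℕ) → List (Edge n × End)
halfEdges n = concatMap (λ e → (e , end₁) ∷ (e , end₂) ∷ []) (allEdges n)

data Sign : Set where
  pos neg : Sign

Signature : ℕ → Set
Signature n = Edge n → Sign

-- Orientations: every half-edge is directed towards or away from its end-vertex

data Dir : Set where
  toward away : Dir

isToward : Dir → Bool
isToward toward = true
isToward away   = false

isAway : Dir → Bool
isAway toward = false
isAway away   = true

Orientation : ℕ → Set
Orientation n = Edge n → End → Dir

SignOK : Sign → Dir → Dir → Set
SignOK pos d₁ d₂ = d₁ ≢ d₂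
SignOK neg d₁ d₂ = d₁ ≡ d₂

Compatible : ∀ {n} → Signature n → Orientation n → Set
Compatible σ ω = ∀ e → SignOK (σ e) (ω e end₁) (ω e end₂)

sumℤ : List ℤ → ℤ
sumℤ = foldr ℤ._+_ 0ℤ

inflow : ∀ {n} → Orientation n → (Edge n → ℤ) → Vertex n → ℤ
inflow {n} ω f w = sumℤ (map (λ { (e , i) →
  if does (endpoint e i ≟V w) ∧ isToward (ω e i) then f e else 0ℤ }) (halfEdges n))

outflow : ∀ {n} → Orientation n → (Edge n → ℤ) → Vertex n → ℤ
outflow {n} ω f w = sumℤ (map (λ { (e , i) →
  if does (endpoint e i ≟V w) ∧ isAway (ω e i) then f e else 0ℤ }) (halfEdges n))

record NZFlow {n : ℕ} (σ : Signature n) (k : ℕ) : Set where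
  field
    orientation  : Orientation n
    compatible   : Compatible σ orientation
    value        : Edge n → ℤ
    nonzero      : ∀ e → value e ≢ 0ℤ
    bounded      : ∀ e → ∣ value e ∣ ℕ.< k
    conservation : ∀ w → inflow orientation value w ≡ outflow orientation value w

FlowAdmissible : ∀ {n} → Signature n → Set
FlowAdmissible σ = ∃ λ k → NZFlow σ k

-- Switching at suitable vertices makes every rung and every edge v_j v_{j+1} except v_m v_0
-- positive.  A flow is then read off rung by rung: if X and Y enter v_j and u_j along the two
-- cycles and R is the value on the rung v_j u_j, the values leaving are X − R and ±(Y + R),
-- with the sign of u_j u_{j+1}, and after all n rungs the pair must be (±X₀ , Y₀) again.
-- A positive u-edge keeps X + Y, a negative one turns X + Y into X′ − Y′, and the nonzero
-- values exclude a few coincidences.  Tracked along the sign pattern of the u-cycle, these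
-- invariants rule out closing up for the signatures switching equivalent to a single negative
-- edge.  For all other patterns and n ≥ 5, a finite automaton over the sign word whose states
-- carry partial flows with values in ±{1,…,4} is checked by evaluation to close up.

module Submission where

open import Defs
open import Data.Bool as Bool using (Bool; true; false; _∧_; if_then_else_)
open import Data.Empty using (⊥-elim)
open import Data.Fin using (Fin; zero; suc; toℕ; fromℕ; inject₁; #_)
open import Data.Fin.Properties
  using (all?; toℕ-injective; toℕ-fromℕ<; toℕ-fromℕ; toℕ-inject₁; toℕ<n; toℕ≤pred[n]) renaming (_≟_ to _≟F_)
open import Data.Integer as ℤ using (ℤ; 0ℤ; _+_; _-_; -_; ∣_∣)
import Data.Integer.Properties as ℤP
open import Data.Integer.Solver using (module +-*-Solver)
open import Data.List using (List; []; _∷_; _++_; map; concatMap; allFin; tabulate)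
import Data.List.Properties as ListP
open import Data.List.Relation.Unary.All as All using (All)
open import Data.List.Relation.Unary.Any as Any using (Any)
open import Data.Nat as ℕ using (ℕ; zero; suc; _≤_; _<_; z≤n; s≤s; _≤?_; _<?_; _⊓_)
import Data.Nat.Properties as ℕP
open import Data.Nat.DivMod using (_mod_; m<n⇒m%n≡m; n%n≡0)
open import Data.Product using (∃-syntax; _×_; _,_; proj₁; proj₂; uncurry)
open import Data.Product.Properties using (≡-dec)
open import Data.Sum using (inj₁; inj₂)
open import Data.Unit using (⊤; tt)
open import Data.Vec using (Vec; []; _∷_; lookup)
open import Function using (_∘_)
open import Relation.Binary.Definitions using (DecidableEquality)
open import Relation.Binary.PropositionalEquality
open import Relation.Nullary using (¬_; Dec; yes; no; does)
open import Relation.Nullary.Decidable using (dec-true; dec-false; ¬?; _×-dec_; _→-dec_; map′; from-yes)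
open import Algebra.Properties.CommutativeSemigroup ℤP.+-commutativeSemigroup using (interchange)

open +-*-Solver using (solve; _:+_; _:-_; :-_; _:=_; con)

_⊗_ : Sign → Sign → Sign
pos ⊗ s = s
neg ⊗ pos = neg
neg ⊗ neg = pos

infixr 7 _⊗_
infixr 8 _·_

_·_ : Sign → ℤ → ℤ
pos · z = z
neg · z = - z

·-involutive : ∀ s z → s · s · z ≡ z
·-involutive pos z = refl
·-involutive neg z = ℤP.neg-involutive z

·-zero : ∀ s → s · 0ℤ ≡ 0ℤ
·-zero pos = refl
·-zero neg = refl

∣·∣ : ∀ s z → ∣ s · z ∣ ≡ ∣ z ∣
∣·∣ pos z = refl
∣·∣ neg z = ℤP.∣-i∣≡∣i∣ z

sumℤ-++ : ∀ xs ys → sumℤ (xs ++ ys) ≡ sumℤ xs + sumℤ ys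
sumℤ-++ []       ys = sym (ℤP.+-identityˡ _)
sumℤ-++ (x ∷ xs) ys = trans (cong (x +_) (sumℤ-++ xs ys)) (sym (ℤP.+-assoc x (sumℤ xs) (sumℤ ys)))

sumℤ-concatMap : ∀ {A B : Set} (g : B → ℤ) (h : A → List B) xs →
  sumℤ (map g (concatMap h xs)) ≡ sumℤ (map (λ x → sumℤ (map g (h x))) xs)
sumℤ-concatMap g h []       = refl
sumℤ-concatMap g h (x ∷ xs) = begin
  sumℤ (map g (h x ++ concatMap h xs))           ≡⟨ cong sumℤ (ListP.map-++ g (h x) _) ⟩
  sumℤ (map g (h x) ++ map g (concatMap h xs))   ≡⟨ sumℤ-++ (map g (h x)) _ ⟩
  sumℤ (map g (h x)) + sumℤ (map g (concatMap h xs))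
                                                  ≡⟨ cong (sumℤ (map g (h x)) +_) (sumℤ-concatMap g h xs) ⟩
  sumℤ (map g (h x)) + sumℤ (map (λ x → sumℤ (map g (h x))) xs) ∎
  where open ≡-Reasoning

sumℤ-cong : ∀ {A : Set} {g h : A → ℤ} → (∀ x → g x ≡ h x) → ∀ xs → sumℤ (map g xs) ≡ sumℤ (map h xs)
sumℤ-cong g≗h xs = cong sumℤ (ListP.map-cong g≗h xs)

sumℤ-+ : ∀ {A : Set} (g h : A → ℤ) xs → sumℤ (map (λ x → g x + h x) xs) ≡ sumℤ (map g xs) + sumℤ (map h xs)
sumℤ-+ g h []       = refl
sumℤ-+ g h (x ∷ xs) = trans (cong (g x + h x +_) (sumℤ-+ g h xs)) (interchange (g x) (h x) _ _)

sumℤ-− : ∀ {A : Set} (g h : A → ℤ) xs → sumℤ (map (λ x → g x - h x) xs) ≡ sumℤ (map g xs) - sumℤ (map h xs)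
sumℤ-− g h []       = refl
sumℤ-− g h (x ∷ xs) = begin
  (g x - h x) + sumℤ (map (λ x → g x - h x) xs)   ≡⟨ cong (g x - h x +_) (sumℤ-− g h xs) ⟩
  (g x - h x) + (G - H)                           ≡⟨ interchange (g x) (- h x) G (- H) ⟩
  (g x + G) + (- h x - H)                         ≡⟨ cong (g x + G +_) (ℤP.neg-distrib-+ (h x) H) ⟨
  (g x + G) - (h x + H)                           ∎
  where
  open ≡-Reasoning
  G H : ℤ
  G = sumℤ (map g xs)
  H = sumℤ (map h xs)

sumFin : ∀ {n} → (Fin n → ℤ) → ℤ
sumFin h = sumℤ (map h (allFin _))

sumFin-tabulate : ∀ n (h : Fin n → ℤ) → sumFin h ≡ sumℤ (tabulate h)
sumFin-tabulate n h = cong sumℤ (ListP.map-tabulate (λ i → i) h)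

sumFin-zero : ∀ n → sumFin (λ (_ : Fin n) → 0ℤ) ≡ 0ℤ
sumFin-zero n = trans (sumFin-tabulate n _) (zeros n)
  where
  zeros : ∀ n → sumℤ (tabulate {n = n} (λ _ → 0ℤ)) ≡ 0ℤ
  zeros zero    = refl
  zeros (suc n) = trans (ℤP.+-identityˡ _) (zeros n)

sumFin-δ : ∀ n (h : Fin n → ℤ) j → sumFin (λ i → if does (i ≟F j) then h i else 0ℤ) ≡ h j
sumFin-δ n h j = trans (sumFin-tabulate n _) (δ n h j)
  where
  δ : ∀ n (h : Fin n → ℤ) j → sumℤ (tabulate (λ i → if does (i ≟F j) then h i else 0ℤ)) ≡ h j
  δ (suc n) h zero    = trans (cong (h zero +_) (trans (sym (sumFin-tabulate n _)) (sumFin-zero n))) (ℤP.+-identityʳ _)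
  δ (suc n) h (suc j) = trans (ℤP.+-identityˡ _) (δ n (h ∘ suc) j)

module _ {m : ℕ} where

  toFin : ℕ → Fin (suc m)
  toFin k = k mod suc m

  prev : Fin (suc m) → Fin (suc m)
  prev zero    = fromℕ m
  prev (suc i) = inject₁ i

  toℕ-toFin : ∀ {k} → k < suc m → toℕ (toFin k) ≡ k
  toℕ-toFin k<n = trans (toℕ-fromℕ< _) (m<n⇒m%n≡m k<n)

  toFin-toℕ : ∀ j → toFin (toℕ j) ≡ j
  toFin-toℕ j = toℕ-injective (toℕ-toFin (toℕ<n j))

  toFin-last : toFin m ≡ fromℕ m
  toFin-last = toℕ-injective (trans (toℕ-toFin (ℕP.n<1+n m)) (sym (toℕ-fromℕ m)))

  toℕ-next : ∀ (i : Fin (suc m)) → toℕ i < m → toℕ (next i) ≡ suc (toℕ i)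
  toℕ-next i i<m = toℕ-toFin (s≤s i<m)

  toℕ-next-last : ∀ (i : Fin (suc m)) → toℕ i ≡ m → toℕ (next i) ≡ 0
  toℕ-next-last i i≡m = trans (toℕ-fromℕ< _) (trans (cong (λ k → suc k ℕ.% suc m) i≡m) (n%n≡0 (suc m)))

  next-prev : ∀ j → next (prev j) ≡ j
  next-prev zero    = toℕ-injective (toℕ-next-last (fromℕ m) (toℕ-fromℕ m))
  next-prev (suc i) = toℕ-injective (begin
    toℕ (next (inject₁ i)) ≡⟨ toℕ-next (inject₁ i) (subst (_< m) (sym (toℕ-inject₁ i)) (toℕ<n i)) ⟩
    suc (toℕ (inject₁ i)) ≡⟨ cong suc (toℕ-inject₁ i) ⟩
    suc (toℕ i)           ∎)
    where open ≡-Reasoning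

  prev-next : ∀ i → prev (next i) ≡ i
  prev-next i with ℕP.m≤n⇒m<n∨m≡n (toℕ≤pred[n] i)
  ... | inj₁ i<m = toℕ-injective (prev-of (next i) (toℕ-next i i<m))
    where
    prev-of : ∀ j → toℕ j ≡ suc (toℕ i) → toℕ (prev j) ≡ toℕ i
    prev-of (suc j) eq = trans (toℕ-inject₁ j) (ℕP.suc-injective eq)
  ... | inj₂ i≡m = begin
    prev (next i) ≡⟨ cong prev (toℕ-injective {j = zero} (toℕ-next-last i i≡m)) ⟩
    fromℕ m       ≡⟨ toℕ-injective (trans (toℕ-fromℕ m) (sym i≡m)) ⟩
    i             ∎
    where open ≡-Reasoning

  toℕ-toFin-< : ∀ {k} → suc k < suc m → toℕ (toFin k) < m
  toℕ-toFin-< {k} k+1<n = subst (_< m) (sym (toℕ-toFin (ℕP.<-trans (ℕP.n<1+n k) k+1<n))) (ℕP.≤-pred k+1<n)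

  prev-toFin : ∀ {k} → suc k < suc m → prev (toFin (suc k)) ≡ toFin k
  prev-toFin {k} k+1<n = begin
    prev (toFin (suc k))               ≡⟨ cong (λ k′ → prev (toFin (suc k′))) (toℕ-toFin k<n) ⟨
    prev (next (toFin k))              ≡⟨ prev-next (toFin k) ⟩
    toFin k                            ∎
    where
    open ≡-Reasoning
    k<n : k < suc m
    k<n = ℕP.<-trans (ℕP.n<1+n k) k+1<n

  does-next≟ : ∀ i j → does (next i ≟F j) ≡ does (i ≟F prev j)
  does-next≟ i j with next i ≟F j | i ≟F prev j
  ... | yes _  | yes _  = refl
  ... | no _   | no _   = refl
  ... | yes eq | no ≢   = ⊥-elim (≢ (trans (sym (prev-next i)) (cong prev eq)))
  ... | no ≢   | yes eq = ⊥-elim (≢ (trans (cong next eq) (next-prev j)))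

if-∧ : ∀ (b c : Bool) (x : ℤ) → (if b ∧ c then x else 0ℤ) ≡ (if b then (if c then x else 0ℤ) else 0ℤ)
if-∧ true  c x = refl
if-∧ false c x = refl

edgeEndSum : ∀ {n} → (Edge n × End → ℤ) → EdgeKind → End → ℤ
edgeEndSum G κ h = sumFin (λ i → G ((κ , i) , h))

halfEdges-sum : ∀ n (G : Edge n × End → ℤ) → let S = edgeEndSum G in
  sumℤ (map G (halfEdges n))
    ≡ (S vv end₁ + S vv end₂) + ((S uu end₁ + S uu end₂) + ((S rung end₁ + S rung end₂) + 0ℤ))
halfEdges-sum n G = begin
  sumℤ (map G (halfEdges n))
    ≡⟨ sumℤ-concatMap G (λ e → (e , end₁) ∷ (e , end₂) ∷ []) (allEdges n) ⟩
  sumℤ (map Φ (allEdges n))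
    ≡⟨ sumℤ-concatMap Φ (λ κ → map (κ ,_) (allFin n)) (vv ∷ uu ∷ rung ∷ []) ⟩
  kind vv + (kind uu + (kind rung + 0ℤ))
    ≡⟨ cong₂ _+_ (split vv) (cong₂ _+_ (split uu) (cong (_+ 0ℤ) (split rung))) ⟩
  _ ∎
  where
  open ≡-Reasoning
  Φ : Edge n → ℤ
  Φ e = G (e , end₁) + (G (e , end₂) + 0ℤ)
  kind : EdgeKind → ℤ
  kind κ = sumℤ (map Φ (map (κ ,_) (allFin n)))
  split : ∀ κ → kind κ ≡ edgeEndSum G κ end₁ + edgeEndSum G κ end₂
  split κ = begin
    kind κ
      ≡⟨ cong sumℤ (ListP.map-∘ (allFin n)) ⟨
    sumFin (λ i → G ((κ , i) , end₁) + (G ((κ , i) , end₂) + 0ℤ))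
      ≡⟨ sumℤ-+ (λ i → G ((κ , i) , end₁)) _ (allFin n) ⟩
    edgeEndSum G κ end₁ + sumFin (λ i → G ((κ , i) , end₂) + 0ℤ)
      ≡⟨ cong (edgeEndSum G κ end₁ +_) (sumℤ-cong (λ i → ℤP.+-identityʳ _) (allFin n)) ⟩
    edgeEndSum G κ end₁ + edgeEndSum G κ end₂ ∎

module _ {m : ℕ} where

  halfEdgesAt : Vertex (suc m) → List (Edge (suc m) × End)
  halfEdgesAt (vS , j) = ((vv , j) , end₁) ∷ ((vv , prev j) , end₂) ∷ ((rung , j) , end₁) ∷ []
  halfEdgesAt (uS , j) = ((uu , j) , end₁) ∷ ((uu , prev j) , end₂) ∷ ((rung , j) , end₂) ∷ []

  atVertex : Vertex (suc m) → (Edge (suc m) × End → ℤ) → Edge (suc m) × End → ℤ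
  atVertex w g (e , h) = if does (endpoint e h ≟V w) then g (e , h) else 0ℤ

  sumFin-δ-next : ∀ (h : Fin (suc m) → ℤ) j → sumFin (λ i → if does (next i ≟F j) then h i else 0ℤ) ≡ h (prev j)
  sumFin-δ-next h j = trans (sumℤ-cong (λ i → cong (λ b → if b then h i else 0ℤ) (does-next≟ i j)) (allFin _))
                       (sumFin-δ (suc m) h (prev j))

  sum-atVertex : ∀ w g → sumℤ (map (atVertex w g) (halfEdges (suc m))) ≡ sumℤ (map g (halfEdgesAt w))
  sum-atVertex (vS , j) g = begin
    sumℤ (map (atVertex (vS , j) g) (halfEdges (suc m)))   ≡⟨ halfEdges-sum (suc m) (atVertex (vS , j) g) ⟩
    (S vv end₁ + S vv end₂) + ((S uu end₁ + S uu end₂) + ((S rung end₁ + S rung end₂) + 0ℤ))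
      ≡⟨ cong₂ _+_ (cong₂ _+_ (δ _) (sumFin-δ-next _ j)) (cong₂ _+_ (cong₂ _+_ O O) (cong (_+ 0ℤ) (cong₂ _+_ (δ _) O))) ⟩
    (a + b) + ((0ℤ + 0ℤ) + ((c + 0ℤ) + 0ℤ))               ≡⟨ reassoc a b c ⟩
    a + (b + (c + 0ℤ))                                     ∎
    where
    open ≡-Reasoning
    S : EdgeKind → End → ℤ
    S = edgeEndSum (atVertex (vS , j) g)
    δ : ∀ (h : Fin (suc m) → ℤ) → sumFin (λ i → if does (i ≟F j) then h i else 0ℤ) ≡ h j
    δ h = sumFin-δ (suc m) h j
    O : sumFin (λ (_ : Fin (suc m)) → 0ℤ) ≡ 0ℤ
    O = sumFin-zero (suc m)
    a b c : ℤ
    a = g ((vv , j) , end₁)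
    b = g ((vv , prev j) , end₂)
    c = g ((rung , j) , end₁)
    reassoc : ∀ a b c → (a + b) + ((0ℤ + 0ℤ) + ((c + 0ℤ) + 0ℤ)) ≡ a + (b + (c + 0ℤ))
    reassoc = solve 3 (λ a b c → (a :+ b) :+ ((con 0ℤ :+ con 0ℤ) :+ ((c :+ con 0ℤ) :+ con 0ℤ))
                                := a :+ (b :+ (c :+ con 0ℤ))) refl
  sum-atVertex (uS , j) g = begin
    sumℤ (map (atVertex (uS , j) g) (halfEdges (suc m)))   ≡⟨ halfEdges-sum (suc m) (atVertex (uS , j) g) ⟩
    (S vv end₁ + S vv end₂) + ((S uu end₁ + S uu end₂) + ((S rung end₁ + S rung end₂) + 0ℤ))
      ≡⟨ cong₂ _+_ (cong₂ _+_ O O) (cong₂ _+_ (cong₂ _+_ (δ _) (sumFin-δ-next _ j)) (cong (_+ 0ℤ) (cong₂ _+_ O (δ _)))) ⟩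
    (0ℤ + 0ℤ) + ((a + b) + ((0ℤ + c) + 0ℤ))               ≡⟨ reassoc a b c ⟩
    a + (b + (c + 0ℤ))                                     ∎
    where
    open ≡-Reasoning
    S : EdgeKind → End → ℤ
    S = edgeEndSum (atVertex (uS , j) g)
    δ : ∀ (h : Fin (suc m) → ℤ) → sumFin (λ i → if does (i ≟F j) then h i else 0ℤ) ≡ h j
    δ h = sumFin-δ (suc m) h j
    O : sumFin (λ (_ : Fin (suc m)) → 0ℤ) ≡ 0ℤ
    O = sumFin-zero (suc m)
    a b c : ℤ
    a = g ((uu , j) , end₁)
    b = g ((uu , prev j) , end₂)
    c = g ((rung , j) , end₂)
    reassoc : ∀ a b c → (0ℤ + 0ℤ) + ((a + b) + ((0ℤ + c) + 0ℤ)) ≡ a + (b + (c + 0ℤ))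
    reassoc = solve 3 (λ a b c → (con 0ℤ :+ con 0ℤ) :+ ((a :+ b) :+ ((con 0ℤ :+ c) :+ con 0ℤ))
                                := a :+ (b :+ (c :+ con 0ℤ))) refl

inSign : Dir → Sign
inSign toward = pos
inSign away   = neg

outSign : Dir → Sign
outSign toward = neg
outSign away   = pos

along : ∀ {n} → Orientation n → (Edge n → ℤ) → Edge n → ℤ
along ω f e = outSign (ω e end₁) · f e

inSign-end₁ : ∀ d x → inSign d · x ≡ - (outSign d · x)
inSign-end₁ toward x = sym (ℤP.neg-involutive x)
inSign-end₁ away   x = refl

inSign-end₂ : ∀ s {d₁ d₂} → SignOK s d₁ d₂ → ∀ x → inSign d₂ · x ≡ s · outSign d₁ · x
inSign-end₂ pos {toward} {toward} ok x = ⊥-elim (ok refl)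
inSign-end₂ pos {toward} {away}   ok x = refl
inSign-end₂ pos {away}   {toward} ok x = refl
inSign-end₂ pos {away}   {away}   ok x = ⊥-elim (ok refl)
inSign-end₂ neg {toward} {toward} ok x = sym (ℤP.neg-involutive x)
inSign-end₂ neg {away}   {away}   ok x = refl

toward-away : ∀ d x → (if isToward d then x else 0ℤ) - (if isAway d then x else 0ℤ) ≡ inSign d · x
toward-away toward x = ℤP.+-identityʳ x
toward-away away   x = ℤP.+-identityˡ (- x)

module _ {m : ℕ} where

  directed : (Dir → Bool) → Orientation (suc m) → (Edge (suc m) → ℤ) → Edge (suc m) × End → ℤ
  directed d ω f (e , h) = if d (ω e h) then f e else 0ℤ

  inValue : Orientation (suc m) → (Edge (suc m) → ℤ) → Edge (suc m) × End → ℤ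
  inValue ω f (e , h) = inSign (ω e h) · f e

  -- Stated for any G agreeing with the summand of inflow or outflow: the pattern-matching
  -- lambdas in their definitions cannot be restated up to definitional equality.
  flow-local : ∀ d ω f w (G : Edge (suc m) × End → ℤ) →
    (∀ e h → G (e , h) ≡ (if does (endpoint e h ≟V w) ∧ d (ω e h) then f e else 0ℤ)) →
    sumℤ (map G (halfEdges (suc m))) ≡ sumℤ (map (directed d ω f) (halfEdgesAt w))
  flow-local d ω f w G G≡ =
    trans (sumℤ-cong (λ { (e , h) → trans (G≡ e h) (if-∧ (does (endpoint e h ≟V w)) (d (ω e h)) (f e)) }) (halfEdges (suc m)))
          (sum-atVertex w (directed d ω f))

  net-local : ∀ ω f w → inflow ω f w - outflow ω f w ≡ sumℤ (map (inValue ω f) (halfEdgesAt w))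
  net-local ω f w = begin
    inflow ω f w - outflow ω f w
      ≡⟨ cong₂ _-_ (flow-local isToward ω f w _ (λ _ _ → refl)) (flow-local isAway ω f w _ (λ _ _ → refl)) ⟩
    sumℤ (map (directed isToward ω f) hs) - sumℤ (map (directed isAway ω f) hs)
      ≡⟨ sumℤ-− (directed isToward ω f) (directed isAway ω f) hs ⟨
    sumℤ (map (λ x → directed isToward ω f x - directed isAway ω f x) hs)
      ≡⟨ sumℤ-cong (λ { (e , h) → toward-away (ω e h) (f e) }) hs ⟩
    sumℤ (map (inValue ω f) hs) ∎
    where
    open ≡-Reasoning
    hs : List (Edge (suc m) × End)
    hs = halfEdgesAt w

  module _ {σ : Signature (suc m)} {ω : Orientation (suc m)} (f : Edge (suc m) → ℤ) (compatible : Compatible σ ω) where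

    private
      A : Edge (suc m) → ℤ
      A = along ω f

      end₁-value : ∀ e → inValue ω f (e , end₁) ≡ - A e
      end₁-value e = inSign-end₁ (ω e end₁) (f e)

      end₂-value : ∀ e → inValue ω f (e , end₂) ≡ σ e · A e
      end₂-value e = inSign-end₂ (σ e) (compatible e) (f e)

    net-vS : ∀ j → inflow ω f (vS , j) - outflow ω f (vS , j)
                   ≡ σ (vv , prev j) · A (vv , prev j) - A (rung , j) - A (vv , j)
    net-vS j = begin
      inflow ω f (vS , j) - outflow ω f (vS , j)   ≡⟨ net-local ω f (vS , j) ⟩
      inValue ω f ((vv , j) , end₁) + (inValue ω f ((vv , prev j) , end₂) + (inValue ω f ((rung , j) , end₁) + 0ℤ))
        ≡⟨ cong₂ _+_ (end₁-value (vv , j)) (cong₂ _+_ (end₂-value (vv , prev j)) (cong (_+ 0ℤ) (end₁-value (rung , j)))) ⟩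
      - A (vv , j) + (σ (vv , prev j) · A (vv , prev j) + (- A (rung , j) + 0ℤ))
        ≡⟨ reorder (A (vv , j)) (σ (vv , prev j) · A (vv , prev j)) (A (rung , j)) ⟩
      σ (vv , prev j) · A (vv , prev j) - A (rung , j) - A (vv , j) ∎
      where
      open ≡-Reasoning
      reorder : ∀ a x r → - a + (x + (- r + 0ℤ)) ≡ x - r - a
      reorder = solve 3 (λ a x r → :- a :+ (x :+ (:- r :+ con 0ℤ)) := x :- r :- a) refl

    net-uS : ∀ j → inflow ω f (uS , j) - outflow ω f (uS , j)
                   ≡ σ (uu , prev j) · A (uu , prev j) + σ (rung , j) · A (rung , j) - A (uu , j)
    net-uS j = begin
      inflow ω f (uS , j) - outflow ω f (uS , j)   ≡⟨ net-local ω f (uS , j) ⟩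
      inValue ω f ((uu , j) , end₁) + (inValue ω f ((uu , prev j) , end₂) + (inValue ω f ((rung , j) , end₂) + 0ℤ))
        ≡⟨ cong₂ _+_ (end₁-value (uu , j)) (cong₂ _+_ (end₂-value (uu , prev j)) (cong (_+ 0ℤ) (end₂-value (rung , j)))) ⟩
      - A (uu , j) + (σ (uu , prev j) · A (uu , prev j) + (σ (rung , j) · A (rung , j) + 0ℤ))
        ≡⟨ reorder (A (uu , j)) (σ (uu , prev j) · A (uu , prev j)) (σ (rung , j) · A (rung , j)) ⟩
      σ (uu , prev j) · A (uu , prev j) + σ (rung , j) · A (rung , j) - A (uu , j) ∎
      where
      open ≡-Reasoning
      reorder : ∀ a y r → - a + (y + (r + 0ℤ)) ≡ y + r - a
      reorder = solve 3 (λ a y r → :- a :+ (y :+ (r :+ con 0ℤ)) := y :+ r :- a) refl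

-- Switching

turn : Sign → Dir → Dir
turn pos d      = d
turn neg toward = away
turn neg away   = toward

SignOK-turn₁ : ∀ a s {d₁ d₂} → SignOK s d₁ d₂ → SignOK (a ⊗ s) (turn a d₁) d₂
SignOK-turn₁ pos s   ok = ok
SignOK-turn₁ neg pos {toward} {toward} ok = ⊥-elim (ok refl)
SignOK-turn₁ neg pos {toward} {away}   ok = refl
SignOK-turn₁ neg pos {away}   {toward} ok = refl
SignOK-turn₁ neg pos {away}   {away}   ok = ⊥-elim (ok refl)
SignOK-turn₁ neg neg {toward} refl = λ ()
SignOK-turn₁ neg neg {away}   refl = λ ()

SignOK-turn₂ : ∀ b s {d₁ d₂} → SignOK s d₁ d₂ → SignOK (s ⊗ b) d₁ (turn b d₂)
SignOK-turn₂ pos pos ok = ok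
SignOK-turn₂ pos neg ok = ok
SignOK-turn₂ neg pos {toward} {toward} ok = ⊥-elim (ok refl)
SignOK-turn₂ neg pos {toward} {away}   ok = refl
SignOK-turn₂ neg pos {away}   {toward} ok = refl
SignOK-turn₂ neg pos {away}   {away}   ok = ⊥-elim (ok refl)
SignOK-turn₂ neg neg {toward} refl = λ ()
SignOK-turn₂ neg neg {away}   refl = λ ()

isToward-turn-neg : ∀ d → isToward (turn neg d) ≡ isAway d
isToward-turn-neg toward = refl
isToward-turn-neg away   = refl

isAway-turn-neg : ∀ d → isAway (turn neg d) ≡ isToward d
isAway-turn-neg toward = refl
isAway-turn-neg away   = refl

⊗-conjugate-involutive : ∀ a s b → a ⊗ (a ⊗ s ⊗ b) ⊗ b ≡ s
⊗-conjugate-involutive pos pos pos = refl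
⊗-conjugate-involutive pos pos neg = refl
⊗-conjugate-involutive pos neg pos = refl
⊗-conjugate-involutive pos neg neg = refl
⊗-conjugate-involutive neg pos pos = refl
⊗-conjugate-involutive neg pos neg = refl
⊗-conjugate-involutive neg neg pos = refl
⊗-conjugate-involutive neg neg neg = refl

NZFlow-cong : ∀ {n} {σ σ′ : Signature n} {k} → (∀ e → σ e ≡ σ′ e) → NZFlow σ k → NZFlow σ′ k
NZFlow-cong σ≗σ′ F = record
  { orientation  = orientation
  ; compatible   = λ e → subst (λ s → SignOK s (orientation e end₁) (orientation e end₂)) (σ≗σ′ e) (compatible e)
  ; value        = value
  ; nonzero      = nonzero
  ; bounded      = bounded
  ; conservation = conservation
  }
  where open NZFlow F

module Switching {n : ℕ} (ε : Vertex n → Sign) where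

  switch : Signature n → Signature n
  switch σ e = ε (endpoint e end₁) ⊗ σ e ⊗ ε (endpoint e end₂)

  switch-involutive : ∀ σ e → switch (switch σ) e ≡ σ e
  switch-involutive σ e = ⊗-conjugate-involutive (ε (endpoint e end₁)) (σ e) (ε (endpoint e end₂))

  switchOrientation : Orientation n → Orientation n
  switchOrientation ω e h = turn (ε (endpoint e h)) (ω e h)

  private
    flow-switch : ∀ ω (f : Edge n → ℤ) w (p q : Dir → Bool) (G G′ : Edge n × End → ℤ) →
      (∀ d → p (turn (ε w) d) ≡ q d) →
      (∀ e h → G (e , h) ≡ (if does (endpoint e h ≟V w) ∧ p (switchOrientation ω e h) then f e else 0ℤ)) →
      (∀ e h → G′ (e , h) ≡ (if does (endpoint e h ≟V w) ∧ q (ω e h) then f e else 0ℤ)) →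
      sumℤ (map G (halfEdges n)) ≡ sumℤ (map G′ (halfEdges n))
    flow-switch ω f w p q G G′ p∘turn≗q G≡ G′≡ = sumℤ-cong (λ { (e , h) → pointwise e h }) (halfEdges n)
      where
      pointwise : ∀ e h → G (e , h) ≡ G′ (e , h)
      pointwise e h rewrite G≡ e h | G′≡ e h with endpoint e h ≟V w
      ... | yes refl = cong (λ b → if b then f e else 0ℤ) (p∘turn≗q (ω e h))
      ... | no _     = refl

  switchFlow : ∀ {σ k} → NZFlow σ k → NZFlow (switch σ) k
  switchFlow {σ} F = record
    { orientation  = ω′
    ; compatible   = λ e → SignOK-turn₁ (ε (endpoint e end₁)) (σ e ⊗ ε (endpoint e end₂))
                             (SignOK-turn₂ (ε (endpoint e end₂)) (σ e) (compatible e))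
    ; value        = value
    ; nonzero      = nonzero
    ; bounded      = bounded
    ; conservation = balanced
    }
    where
    open NZFlow F
    ω′ : Orientation n
    ω′ = switchOrientation orientation
    balanced : ∀ w → inflow ω′ value w ≡ outflow ω′ value w
    balanced w with ε w in εw
    ... | pos = begin
      inflow ω′ value w
        ≡⟨ flow-switch orientation value w isToward isToward _ _ (turned isToward) (λ _ _ → refl) (λ _ _ → refl) ⟩
      inflow orientation value w
        ≡⟨ conservation w ⟩
      outflow orientation value w
        ≡⟨ flow-switch orientation value w isAway isAway _ _ (turned isAway) (λ _ _ → refl) (λ _ _ → refl) ⟨
      outflow ω′ value w ∎
      where
      open ≡-Reasoning
      turned : ∀ (p : Dir → Bool) d → p (turn (ε w) d) ≡ p d
      turned p d = cong (λ s → p (turn s d)) εw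
    ... | neg = begin
      inflow ω′ value w
        ≡⟨ flow-switch orientation value w isToward isAway _ _ (turned isToward isAway isToward-turn-neg)
                       (λ _ _ → refl) (λ _ _ → refl) ⟩
      outflow orientation value w
        ≡⟨ conservation w ⟨
      inflow orientation value w
        ≡⟨ flow-switch orientation value w isAway isToward _ _ (turned isAway isToward isAway-turn-neg)
                       (λ _ _ → refl) (λ _ _ → refl) ⟨
      outflow ω′ value w ∎
      where
      open ≡-Reasoning
      turned : ∀ (p q : Dir → Bool) → (∀ d → p (turn neg d) ≡ q d) → ∀ d → p (turn (ε w) d) ≡ q d
      turned p q turn-neg d = trans (cong (λ s → p (turn s d)) εw) (turn-neg d)

record Normal {m : ℕ} (σ : Signature (suc m)) : Set where
  field
    rung-pos : ∀ j → σ (rung , j) ≡ pos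
    vv-pos   : ∀ j → toℕ j < m → σ (vv , j) ≡ pos

⊗-square : ∀ a s → a ⊗ s ⊗ a ⊗ s ≡ pos
⊗-square pos pos = refl
⊗-square pos neg = refl
⊗-square neg pos = refl
⊗-square neg neg = refl

module Normalisation {m : ℕ} (σ : Signature (suc m)) where

  potential : ℕ → Sign
  potential zero    = pos
  potential (suc k) = potential k ⊗ σ (vv , toFin k)

  normaliser : Vertex (suc m) → Sign
  normaliser (vS , j) = potential (toℕ j)
  normaliser (uS , j) = potential (toℕ j) ⊗ σ (rung , j)

  open Switching normaliser using (switch)

  switch-normal : Normal (switch σ)
  switch-normal = record
    { rung-pos = λ j → ⊗-square (potential (toℕ j)) (σ (rung , j))
    ; vv-pos   = vv-pos
    }
    where
    vv-pos : ∀ j → toℕ j < m → switch σ (vv , j) ≡ pos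
    vv-pos j j<m rewrite toℕ-next j j<m | toFin-toℕ j = ⊗-square (potential (toℕ j)) (σ (vv , j))

-- Flows on normal signatures as runs along the ladder

Valid : ℕ → ℤ → Set
Valid k z = z ≢ 0ℤ × ∣ z ∣ < k

·-valid : ∀ s {k z} → Valid k z → Valid k (s · z)
·-valid s {k} {z} (z≢0 , z<k) = s·z≢0 , subst (_< k) (sym (∣·∣ s z)) z<k
  where
  s·z≢0 : s · z ≢ 0ℤ
  s·z≢0 s·z≡0 = z≢0 (trans (sym (·-involutive s z)) (trans (cong (s ·_) s·z≡0) (·-zero s)))

State : Set
State = ℤ × ℤ

move : Sign → State → ℤ → State
move t (X , Y) R = X - R , t · (Y + R)

close : Sign → State → State
close ρ (X , Y) = ρ · X , Y

Transfer : (ℤ → Set) → State → ℤ → Set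
Transfer V (X , Y) R = V R × V (X - R) × V (Y + R)

-- Before rung k the state (X , Y) holds the values entering v_k and u_k along the two
-- cycles; R is the value on the rung v_k u_k and τ k the sign of u_k u_{k+1}.
data Run (V : ℤ → Set) (τ : ℕ → Sign) (p₀ : State) : ℕ → State → Set where
  start : Run V τ p₀ 0 p₀
  step  : ∀ {k p} → Run V τ p₀ k p → (R : ℤ) → Transfer V p R → Run V τ p₀ (suc k) (move (τ k) p R)

module _ {V : ℤ → Set} {τ : ℕ → Sign} {p₀ : State} where

  stateAt : ∀ {k p} → Run V τ p₀ k p → ℕ → State
  stateAt start                 i = p₀
  stateAt (step {k} {p} r R _)  i = if does (i ≤? k) then stateAt r i else move (τ k) p R

  rungAt : ∀ {k p} → Run V τ p₀ k p → ℕ → ℤ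
  rungAt start            i = 0ℤ
  rungAt (step {k} r R _) i = if does (i <? k) then rungAt r i else R

  stateAt-initial : ∀ {k p} (r : Run V τ p₀ k p) → stateAt r 0 ≡ p₀
  stateAt-initial start            = refl
  stateAt-initial (step {k} r R _) rewrite dec-true (0 ≤? k) z≤n = stateAt-initial r

  stateAt-final : ∀ {k p} (r : Run V τ p₀ k p) → stateAt r k ≡ p
  stateAt-final start            = refl
  stateAt-final (step {k} r R _) rewrite dec-false (suc k ≤? k) ℕP.1+n≰n = refl

  stateAt-step : ∀ {k p} (r : Run V τ p₀ k p) {i} → i < k →
    Transfer V (stateAt r i) (rungAt r i) × stateAt r (suc i) ≡ move (τ i) (stateAt r i) (rungAt r i)
  stateAt-step (step {k} r R t) {i} i<1+k with ℕP.m≤n⇒m<n∨m≡n (ℕP.≤-pred i<1+k)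
  ... | inj₁ i<k rewrite dec-true (i ≤? k) (ℕP.<⇒≤ i<k) | dec-true (suc i ≤? k) i<k
    = stateAt-step r i<k
  ... | inj₂ refl rewrite dec-true (i ≤? i) ℕP.≤-refl | dec-false (suc i ≤? i) ℕP.1+n≰n | stateAt-final r
    = t , refl

module _ {m : ℕ} where

  cycleWord : Signature (suc m) → ℕ → Sign
  cycleWord σ s = σ (uu , toFin s)

  lastSign : Signature (suc m) → Sign
  lastSign σ = σ (vv , fromℕ m)

  ClosedRun : Signature (suc m) → ℕ → Set
  ClosedRun σ k = ∃[ p₀ ] Run (Valid k) (cycleWord σ) p₀ (suc m) (close (lastSign σ) p₀)

module FromFlow {m : ℕ} {σ : Signature (suc m)} (normal : Normal σ) {k : ℕ} (F : NZFlow σ k) where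

  open NZFlow F
  open Normal normal

  private
    τ : ℕ → Sign
    τ = cycleWord σ

    ρ : Sign
    ρ = lastSign σ

    A : Edge (suc m) → ℤ
    A = along orientation value

  X Y R : ℕ → ℤ
  X zero    = ρ · A (vv , fromℕ m)
  X (suc s) = A (vv , toFin s)
  Y zero    = σ (uu , fromℕ m) · A (uu , fromℕ m)
  Y (suc s) = τ s · A (uu , toFin s)
  R s       = A (rung , toFin s)

  valid-along : ∀ e → Valid k (A e)
  valid-along e = ·-valid (outSign (orientation e end₁)) (nonzero e , bounded e)

  incoming-v : ∀ s → s < suc m → σ (vv , prev (toFin s)) · A (vv , prev (toFin s)) ≡ X s
  incoming-v zero    _   = refl
  incoming-v (suc s) s<n rewrite prev-toFin s<n | vv-pos (toFin s) (toℕ-toFin-< s<n) = refl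

  incoming-u : ∀ s → s < suc m → σ (uu , prev (toFin s)) · A (uu , prev (toFin s)) ≡ Y s
  incoming-u zero    _   = refl
  incoming-u (suc s) s<n rewrite prev-toFin s<n = refl

  net-zero : ∀ w → inflow orientation value w - outflow orientation value w ≡ 0ℤ
  net-zero w = ℤP.i≡j⇒i-j≡0 (conservation w)

  v-step : ∀ s → s < suc m → X s - R s ≡ A (vv , toFin s)
  v-step s s<n = ℤP.i-j≡0⇒i≡j _ _ (begin
    X s - R s - A (vv , toFin s)
      ≡⟨ cong (λ x → x - R s - A (vv , toFin s)) (incoming-v s s<n) ⟨
    σ (vv , prev (toFin s)) · A (vv , prev (toFin s)) - R s - A (vv , toFin s)
      ≡⟨ net-vS value compatible (toFin s) ⟨
    inflow orientation value (vS , toFin s) - outflow orientation value (vS , toFin s)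
      ≡⟨ net-zero (vS , toFin s) ⟩
    0ℤ ∎)
    where open ≡-Reasoning

  u-step : ∀ s → s < suc m → Y s + R s ≡ A (uu , toFin s)
  u-step s s<n = ℤP.i-j≡0⇒i≡j _ _ (begin
    Y s + R s - A (uu , toFin s)
      ≡⟨ cong₂ (λ y t → y + t · R s - A (uu , toFin s)) (incoming-u s s<n) (rung-pos (toFin s)) ⟨
    σ (uu , prev (toFin s)) · A (uu , prev (toFin s)) + σ (rung , toFin s) · R s - A (uu , toFin s)
      ≡⟨ net-uS value compatible (toFin s) ⟨
    inflow orientation value (uS , toFin s) - outflow orientation value (uS , toFin s)
      ≡⟨ net-zero (uS , toFin s) ⟩
    0ℤ ∎)
    where open ≡-Reasoning

  run : ∀ s → s ≤ suc m → Run (Valid k) τ (X 0 , Y 0) s (X s , Y s)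
  run zero    _   = start
  run (suc s) s<n = subst (Run (Valid k) τ (X 0 , Y 0) (suc s)) (cong₂ _,_ (v-step s s<n) (cong (τ s ·_) (u-step s s<n)))
    (step (run s (ℕP.<⇒≤ s<n)) (R s)
      (valid-along _ , subst (Valid k) (sym (v-step s s<n)) (valid-along _)
                     , subst (Valid k) (sym (u-step s s<n)) (valid-along _)))

  run-closes : (X (suc m) , Y (suc m)) ≡ close ρ (X 0 , Y 0)
  run-closes = cong₂ _,_
    (trans (cong (λ j → A (vv , j)) toFin-last) (sym (·-involutive ρ _)))
    (cong (λ j → σ (uu , j) · A (uu , j)) toFin-last)

  closedRun : ClosedRun σ k
  closedRun = (X 0 , Y 0) , subst (Run (Valid k) τ (X 0 , Y 0) (suc m)) run-closes (run (suc m) ℕP.≤-refl)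

module ToFlow {m : ℕ} {σ : Signature (suc m)} (normal : Normal σ) {k : ℕ} (p₀ : State)
              (r : Run (Valid k) (cycleWord σ) p₀ (suc m) (close (lastSign σ) p₀)) where

  open Normal normal

  private
    τ : ℕ → Sign
    τ = cycleWord σ

    ρ : Sign
    ρ = lastSign σ

  x y R : ℕ → ℤ
  x i = proj₁ (stateAt r i)
  y i = proj₂ (stateAt r i)
  R   = rungAt r

  transfer : ∀ (j : Fin (suc m)) → Transfer (Valid k) (stateAt r (toℕ j)) (R (toℕ j))
  transfer j = proj₁ (stateAt-step r (toℕ<n j))

  x-step : ∀ i → i < suc m → x (suc i) ≡ x i - R i
  x-step i i<n = cong proj₁ (proj₂ (stateAt-step r i<n))

  y-step : ∀ i → i < suc m → y (suc i) ≡ τ i · (y i + R i)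
  y-step i i<n = cong proj₂ (proj₂ (stateAt-step r i<n))

  value : Edge (suc m) → ℤ
  value (vv , j)   = x (toℕ j) - R (toℕ j)
  value (uu , j)   = y (toℕ j) + R (toℕ j)
  value (rung , j) = R (toℕ j)

  valid : ∀ e → Valid k (value e)
  valid (vv , j)   = proj₁ (proj₂ (transfer j))
  valid (uu , j)   = proj₂ (proj₂ (transfer j))
  valid (rung , j) = proj₁ (transfer j)

  orientation : Orientation (suc m)
  orientation e end₁ = away
  orientation e end₂ = turn (σ e) toward

  compatible : Compatible σ orientation
  compatible e with σ e
  ... | pos = λ ()
  ... | neg = refl

  incoming-v : ∀ j → σ (vv , prev j) · value (vv , prev j) ≡ x (toℕ j)
  incoming-v zero = begin
    ρ · value (vv , fromℕ m)          ≡⟨ cong (λ i → ρ · (x i - R i)) (toℕ-fromℕ m) ⟩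
    ρ · (x m - R m)                   ≡⟨ cong (ρ ·_) (x-step m (ℕP.n<1+n m)) ⟨
    ρ · x (suc m)                     ≡⟨ cong (λ p → ρ · proj₁ p) (stateAt-final r) ⟩
    ρ · ρ · proj₁ p₀                  ≡⟨ ·-involutive ρ (proj₁ p₀) ⟩
    proj₁ p₀                          ≡⟨ cong proj₁ (stateAt-initial r) ⟨
    x 0                               ∎
    where open ≡-Reasoning
  incoming-v (suc i) = begin
    σ (vv , inject₁ i) · value (vv , inject₁ i) ≡⟨ cong (_· value (vv , inject₁ i)) (vv-pos (inject₁ i) i<m) ⟩
    x (toℕ (inject₁ i)) - R (toℕ (inject₁ i))   ≡⟨ cong (λ i → x i - R i) (toℕ-inject₁ i) ⟩
    x (toℕ i) - R (toℕ i)                       ≡⟨ x-step (toℕ i) (ℕP.<-trans (toℕ<n i) (ℕP.n<1+n m)) ⟨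
    x (suc (toℕ i))                             ∎
    where
    open ≡-Reasoning
    i<m : toℕ (inject₁ i) < m
    i<m = subst (_< m) (sym (toℕ-inject₁ i)) (toℕ<n i)

  outgoing-u : ∀ p → σ (uu , p) · value (uu , p) ≡ y (suc (toℕ p))
  outgoing-u p = begin
    σ (uu , p) · value (uu , p)                ≡⟨ cong (λ q → σ (uu , q) · value (uu , p)) (toFin-toℕ p) ⟨
    τ (toℕ p) · (y (toℕ p) + R (toℕ p))        ≡⟨ y-step (toℕ p) (toℕ<n p) ⟨
    y (suc (toℕ p))                            ∎
    where open ≡-Reasoning

  incoming-u : ∀ j → σ (uu , prev j) · value (uu , prev j) ≡ y (toℕ j)
  incoming-u zero = begin
    σ (uu , fromℕ m) · value (uu , fromℕ m)    ≡⟨ outgoing-u (fromℕ m) ⟩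
    y (suc (toℕ (fromℕ m)))                    ≡⟨ cong (λ i → y (suc i)) (toℕ-fromℕ m) ⟩
    y (suc m)                                  ≡⟨ cong proj₂ (stateAt-final r) ⟩
    proj₂ p₀                                   ≡⟨ cong proj₂ (stateAt-initial r) ⟨
    y 0                                        ∎
    where open ≡-Reasoning
  incoming-u (suc i) = trans (outgoing-u (inject₁ i)) (cong (λ i → y (suc i)) (toℕ-inject₁ i))

  conservation : ∀ w → inflow orientation value w ≡ outflow orientation value w
  conservation (vS , j) = ℤP.i-j≡0⇒i≡j _ _ (begin
    inflow orientation value (vS , j) - outflow orientation value (vS , j)
      ≡⟨ net-vS value compatible j ⟩
    σ (vv , prev j) · value (vv , prev j) - value (rung , j) - value (vv , j)
      ≡⟨ cong (λ z → z - value (rung , j) - value (vv , j)) (incoming-v j) ⟩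
    value (vv , j) - value (vv , j)
      ≡⟨ ℤP.+-inverseʳ (value (vv , j)) ⟩
    0ℤ ∎)
    where open ≡-Reasoning
  conservation (uS , j) = ℤP.i-j≡0⇒i≡j _ _ (begin
    inflow orientation value (uS , j) - outflow orientation value (uS , j)
      ≡⟨ net-uS value compatible j ⟩
    σ (uu , prev j) · value (uu , prev j) + σ (rung , j) · value (rung , j) - value (uu , j)
      ≡⟨ cong₂ (λ z t → z + t · value (rung , j) - value (uu , j)) (incoming-u j) (rung-pos j) ⟩
    value (uu , j) - value (uu , j)
      ≡⟨ ℤP.+-inverseʳ (value (uu , j)) ⟩
    0ℤ ∎)
    where open ≡-Reasoning

  flow : NZFlow σ k
  flow = record
    { orientation  = orientation
    ; compatible   = compatible
    ; value        = value
    ; nonzero      = λ e → proj₁ (valid e)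
    ; bounded      = λ e → proj₂ (valid e)
    ; conservation = conservation
    }

flow⇒closedRun : ∀ {m} {σ : Signature (suc m)} {k} → Normal σ → NZFlow σ k → ClosedRun σ k
flow⇒closedRun normal F = FromFlow.closedRun normal F

closedRun⇒flow : ∀ {m} {σ : Signature (suc m)} {k} → Normal σ → ClosedRun σ k → NZFlow σ k
closedRun⇒flow normal (p₀ , r) = ToFlow.flow normal p₀ r

-- The obstruction

-- The shape of the word of u-cycle signs read so far: P is a nonempty block of positive
-- signs, N a single negative sign.  ⟨NN⟩ and ⟨NNP⟩ also cover these shapes after a
-- leading P, ⟨NPNP⟩ also covers PNPNP, and ⟨NNN⟩ every word with three negative signs.
data Shape : Set where
  ⟨⟩ ⟨P⟩ ⟨N⟩ ⟨NP⟩ ⟨PN⟩ ⟨PNP⟩ ⟨NN⟩ ⟨NNP⟩ ⟨NPN⟩ ⟨PNPN⟩ ⟨NPNP⟩ ⟨NNN⟩ : Shape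

shapeStep : Shape → Sign → Shape
shapeStep ⟨⟩     pos = ⟨P⟩
shapeStep ⟨⟩     neg = ⟨N⟩
shapeStep ⟨P⟩    pos = ⟨P⟩
shapeStep ⟨P⟩    neg = ⟨PN⟩
shapeStep ⟨N⟩    pos = ⟨NP⟩
shapeStep ⟨N⟩    neg = ⟨NN⟩
shapeStep ⟨NP⟩   pos = ⟨NP⟩
shapeStep ⟨NP⟩   neg = ⟨NPN⟩
shapeStep ⟨PN⟩   pos = ⟨PNP⟩
shapeStep ⟨PN⟩   neg = ⟨NN⟩
shapeStep ⟨PNP⟩  pos = ⟨PNP⟩
shapeStep ⟨PNP⟩  neg = ⟨PNPN⟩
shapeStep ⟨NN⟩   pos = ⟨NNP⟩
shapeStep ⟨NNP⟩  pos = ⟨NNP⟩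
shapeStep ⟨NPN⟩  pos = ⟨NPNP⟩
shapeStep ⟨PNPN⟩ pos = ⟨NPNP⟩
shapeStep ⟨NPNP⟩ pos = ⟨NPNP⟩
shapeStep _      _   = ⟨NNN⟩

shapeAfter : (ℕ → Sign) → ℕ → Shape
shapeAfter τ zero    = ⟨⟩
shapeAfter τ (suc k) = shapeStep (shapeAfter τ k) (τ k)

-- False exactly for the normal signatures that are switching equivalent to one with a
-- single negative edge.
admissible : Shape → Sign → Bool
admissible ⟨⟩     pos = true
admissible ⟨P⟩    pos = true
admissible ⟨N⟩    neg = true
admissible ⟨NP⟩   neg = true
admissible ⟨PN⟩   neg = true
admissible ⟨PNP⟩  neg = true
admissible ⟨NNP⟩  neg = true
admissible ⟨PNPN⟩ pos = true
admissible ⟨NPNP⟩ _   = true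
admissible ⟨NNN⟩  _   = true
admissible _      _   = false

add sub : State → ℤ
add (X , Y) = X + Y
sub (X , Y) = X - Y

double-zero : ∀ z → z + z ≡ 0ℤ → z ≡ 0ℤ
double-zero (ℤ.+ zero)    _  = refl
double-zero (ℤ.+ (suc n)) ()
double-zero ℤ.-[1+ n ]    ()

half-zero : ∀ z {a b} → z + z ≡ a - b → a ≡ b → z ≡ 0ℤ
half-zero z z+z≡a-b a≡b = double-zero z (trans z+z≡a-b (ℤP.i≡j⇒i-j≡0 a≡b))

add-pos : ∀ p R → add (move pos p R) ≡ add p
add-pos (X , Y) R = solve 3 (λ X Y R → (X :- R) :+ (Y :+ R) := X :+ Y) refl X Y R

sub-neg : ∀ p R → sub (move neg p R) ≡ add p
sub-neg (X , Y) R = solve 3 (λ X Y R → (X :- R) :- :- (Y :+ R) := X :+ Y) refl X Y R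

add≢sub : ∀ p → proj₂ p ≢ 0ℤ → add p ≢ sub p
add≢sub (X , Y) Y≢0 eq = Y≢0 (half-zero Y (solve 2 (λ X Y → Y :+ Y := (X :+ Y) :- (X :- Y)) refl X Y) eq)

add≢-sub : ∀ p → proj₁ p ≢ 0ℤ → add p ≢ - sub p
add≢-sub (X , Y) X≢0 eq = X≢0 (half-zero X (solve 2 (λ X Y → X :+ X := (X :+ Y) :- :- (X :- Y)) refl X Y) eq)

add-neg≢sub : ∀ p R → R ≢ 0ℤ → add (move neg p R) ≢ sub p
add-neg≢sub (X , Y) R R≢0 eq =
  R≢0 (half-zero R (solve 3 (λ X Y R → R :+ R := (X :- Y) :- ((X :- R) :+ :- (Y :+ R))) refl X Y R) (sym eq))

Invariant : Shape → State → State → Set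
Invariant ⟨⟩     p₀ p = p ≡ p₀
Invariant ⟨P⟩    p₀ p = add p ≡ add p₀
Invariant ⟨N⟩    p₀ p = sub p ≡ add p₀ × add p ≢ sub p₀ × add p ≢ add p₀ × add p ≢ - add p₀
Invariant ⟨NP⟩   p₀ p = add p ≢ sub p₀ × add p ≢ add p₀ × add p ≢ - add p₀
Invariant ⟨PN⟩   p₀ p = sub p ≡ add p₀ × add p ≢ add p₀ × add p ≢ - add p₀
Invariant ⟨PNP⟩  p₀ p = add p ≢ add p₀ × add p ≢ - add p₀
Invariant ⟨NN⟩   p₀ p = add p ≢ add p₀ × sub p ≢ - add p₀
Invariant ⟨NNP⟩  p₀ p = add p ≢ add p₀
Invariant ⟨NPN⟩  p₀ p = sub p ≢ sub p₀ × sub p ≢ - add p₀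
Invariant ⟨PNPN⟩ p₀ p = sub p ≢ - add p₀
Invariant ⟨NPNP⟩ p₀ p = ⊤
Invariant ⟨NNN⟩  p₀ p = ⊤

module _ {p₀ : State} where

  invariant-pos : ∀ i p R → Invariant i p₀ p → Invariant (shapeStep i pos) p₀ (move pos p R)
  invariant-pos ⟨⟩     p R refl = add-pos p R
  invariant-pos ⟨P⟩    p R inv  = trans (add-pos p R) inv
  invariant-pos ⟨N⟩    p R (_ , inv) rewrite add-pos p R = inv
  invariant-pos ⟨NP⟩   p R inv rewrite add-pos p R = inv
  invariant-pos ⟨PN⟩   p R (_ , inv) rewrite add-pos p R = inv
  invariant-pos ⟨PNP⟩  p R inv rewrite add-pos p R = inv
  invariant-pos ⟨NN⟩   p R (inv , _) rewrite add-pos p R = inv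
  invariant-pos ⟨NNP⟩  p R inv rewrite add-pos p R = inv
  invariant-pos ⟨NPN⟩  p R _ = tt
  invariant-pos ⟨PNPN⟩ p R _ = tt
  invariant-pos ⟨NPNP⟩ p R _ = tt
  invariant-pos ⟨NNN⟩  p R _ = tt

  invariant-neg : ∀ {k} i p R → Transfer (Valid k) p R → Invariant i p₀ p → Invariant (shapeStep i neg) p₀ (move neg p R)
  invariant-neg i p R ((R≢0 , _) , (X′≢0 , _) , valid-Y+R) = go i
    where
    q : State
    q = move neg p R
    q-sub : sub q ≡ add p
    q-sub = sub-neg p R
    add-q≢sub-q : ∀ {z} → add q ≡ z → z ≢ sub q
    add-q≢sub-q eq z≡ = add≢sub q (proj₁ (·-valid neg valid-Y+R)) (trans eq z≡)
    add-q≢-sub-q : ∀ {z} → add q ≡ z → z ≢ - sub q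
    add-q≢-sub-q eq z≡ = add≢-sub q X′≢0 (trans eq z≡)
    go : ∀ i → Invariant i p₀ p → Invariant (shapeStep i neg) p₀ q
    go ⟨⟩ refl =
      q-sub , add-neg≢sub p R R≢0 , (λ eq → add-q≢sub-q eq (sym q-sub)) , (λ eq → add-q≢-sub-q eq (cong -_ (sym q-sub)))
    go ⟨P⟩ add≡add₀ =
      trans q-sub add≡add₀ , (λ eq → add-q≢sub-q eq (sym (trans q-sub add≡add₀)))
                           , (λ eq → add-q≢-sub-q eq (cong -_ (sym (trans q-sub add≡add₀))))
    go ⟨N⟩ (sub≡add₀ , _ , _ , add≢-add₀) =
      (λ eq → add-neg≢sub p R R≢0 (trans eq (sym sub≡add₀))) , (λ eq → add≢-add₀ (trans (sym q-sub) eq))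
    go ⟨PN⟩ (sub≡add₀ , _ , add≢-add₀) =
      (λ eq → add-neg≢sub p R R≢0 (trans eq (sym sub≡add₀))) , (λ eq → add≢-add₀ (trans (sym q-sub) eq))
    go ⟨NP⟩ (add≢sub₀ , _ , add≢-add₀) =
      (λ eq → add≢sub₀ (trans (sym q-sub) eq)) , (λ eq → add≢-add₀ (trans (sym q-sub) eq))
    go ⟨PNP⟩ (_ , add≢-add₀) = λ eq → add≢-add₀ (trans (sym q-sub) eq)
    go ⟨NN⟩   _ = tt
    go ⟨NNP⟩  _ = tt
    go ⟨NPN⟩  _ = tt
    go ⟨PNPN⟩ _ = tt
    go ⟨NPNP⟩ _ = tt
    go ⟨NNN⟩  _ = tt

  run-invariant : ∀ {k τ j p} → Run (Valid k) τ p₀ j p → Invariant (shapeAfter τ j) p₀ p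
  run-invariant start = refl
  run-invariant {τ = τ} (step {j} {p} r R t) with τ j
  ... | pos = invariant-pos (shapeAfter τ j) p R (run-invariant r)
  ... | neg = invariant-neg (shapeAfter τ j) p R t (run-invariant r)

sub-close-neg : ∀ p → sub (close neg p) ≡ - add p
sub-close-neg (X , Y) = solve 2 (λ X Y → :- X :- Y := :- (X :+ Y)) refl X Y

invariant-close : ∀ i ρ {p₀} → proj₁ p₀ ≢ 0ℤ → admissible i ρ ≡ false → ¬ Invariant i p₀ (close ρ p₀)
invariant-close ⟨N⟩    pos _ _ (_ , _ , ne , _) = ne refl
invariant-close ⟨NP⟩   pos _ _ (_ , ne , _)     = ne refl
invariant-close ⟨PN⟩   pos _ _ (_ , ne , _)     = ne refl
invariant-close ⟨PNP⟩  pos _ _ (ne , _)         = ne refl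
invariant-close ⟨NN⟩   pos _ _ (ne , _)         = ne refl
invariant-close ⟨NNP⟩  pos _ _ ne               = ne refl
invariant-close ⟨NPN⟩  pos _ _ (ne , _)         = ne refl
invariant-close ⟨⟩     neg {X₀ , Y₀} X₀≢0 _ eq =
  X₀≢0 (half-zero X₀ (solve 1 (λ X → X :+ X := X :- :- X) refl X₀) (sym (cong proj₁ eq)))
invariant-close ⟨P⟩    neg {X₀ , Y₀} X₀≢0 _ eq =
  X₀≢0 (half-zero X₀ (solve 2 (λ X Y → X :+ X := (X :+ Y) :- (:- X :+ Y)) refl X₀ Y₀) (sym eq))
invariant-close ⟨NN⟩   neg {X₀ , Y₀} _ _ (_ , ne) = ne (sub-close-neg (X₀ , Y₀))
invariant-close ⟨NPN⟩  neg {X₀ , Y₀} _ _ (_ , ne) = ne (sub-close-neg (X₀ , Y₀))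
invariant-close ⟨PNPN⟩ neg {X₀ , Y₀} _ _ ne       = ne (sub-close-neg (X₀ , Y₀))
invariant-close ⟨⟩     pos _ ()
invariant-close ⟨P⟩    pos _ ()
invariant-close ⟨PNPN⟩ pos _ ()
invariant-close ⟨NPNP⟩ _   _ ()
invariant-close ⟨NNN⟩  _   _ ()
invariant-close ⟨N⟩    neg _ ()
invariant-close ⟨NP⟩   neg _ ()
invariant-close ⟨PN⟩   neg _ ()
invariant-close ⟨PNP⟩  neg _ ()
invariant-close ⟨NNP⟩  neg _ ()

run-final-valid : ∀ {V τ p₀ k p} → Run V τ p₀ (suc k) p → V (proj₁ p)
run-final-valid (step r R (_ , valid-X , _)) = valid-X

closedRun⇒admissible : ∀ {m} {σ : Signature (suc m)} {k} → ClosedRun σ k →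
  admissible (shapeAfter (cycleWord σ) (suc m)) (lastSign σ) ≡ true
closedRun⇒admissible {m} {σ} (p₀ , r) with admissible (shapeAfter (cycleWord σ) (suc m)) (lastSign σ) in eq
... | true  = refl
... | false = ⊥-elim (invariant-close _ ρ X₀≢0 eq (run-invariant r))
  where
  ρ : Sign
  ρ = lastSign σ
  X₀≢0 : proj₁ p₀ ≢ 0ℤ
  X₀≢0 X₀≡0 = proj₁ (run-final-valid r) (trans (cong (ρ ·_) X₀≡0) (·-zero ρ))

-- Certified closing runs

shapes : Vec Shape 12
shapes = ⟨⟩ ∷ ⟨P⟩ ∷ ⟨N⟩ ∷ ⟨NP⟩ ∷ ⟨PN⟩ ∷ ⟨PNP⟩ ∷ ⟨NN⟩ ∷ ⟨NNP⟩ ∷ ⟨NPN⟩ ∷ ⟨PNPN⟩ ∷ ⟨NPNP⟩ ∷ ⟨NNN⟩ ∷ []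

shapeIndex : Shape → Fin 12
shapeIndex ⟨⟩     = # 0
shapeIndex ⟨P⟩    = # 1
shapeIndex ⟨N⟩    = # 2
shapeIndex ⟨NP⟩   = # 3
shapeIndex ⟨PN⟩   = # 4
shapeIndex ⟨PNP⟩  = # 5
shapeIndex ⟨NN⟩   = # 6
shapeIndex ⟨NNP⟩  = # 7
shapeIndex ⟨NPN⟩  = # 8
shapeIndex ⟨PNPN⟩ = # 9
shapeIndex ⟨NPNP⟩ = # 10
shapeIndex ⟨NNN⟩  = # 11

lookup-shapeIndex : ∀ s → lookup shapes (shapeIndex s) ≡ s
lookup-shapeIndex ⟨⟩     = refl
lookup-shapeIndex ⟨P⟩    = refl
lookup-shapeIndex ⟨N⟩    = refl
lookup-shapeIndex ⟨NP⟩   = refl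
lookup-shapeIndex ⟨PN⟩   = refl
lookup-shapeIndex ⟨PNP⟩  = refl
lookup-shapeIndex ⟨NN⟩   = refl
lookup-shapeIndex ⟨NNP⟩  = refl
lookup-shapeIndex ⟨NPN⟩  = refl
lookup-shapeIndex ⟨PNPN⟩ = refl
lookup-shapeIndex ⟨NPNP⟩ = refl
lookup-shapeIndex ⟨NNN⟩  = refl

_≟ˢ_ : DecidableEquality Shape
s ≟ˢ s′ = map′ (λ eq → trans (sym (lookup-shapeIndex s)) (trans (cong (lookup shapes) eq) (lookup-shapeIndex s′)))
               (cong shapeIndex) (shapeIndex s ≟F shapeIndex s′)

_≟ₛ_ : DecidableEquality State
_≟ₛ_ = ≡-dec ℤ._≟_ ℤ._≟_

valid? : ∀ k z → Dec (Valid k z)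
valid? k z = ¬? (z ℤ.≟ 0ℤ) ×-dec (∣ z ∣ ℕ.<? k)

suc-⊓ : ∀ k h → suc (k ⊓ h) ⊓ h ≡ suc k ⊓ h
suc-⊓ k zero    = refl
suc-⊓ k (suc h) = cong suc (trans (ℕP.⊓-assoc k (suc h) h) (cong (k ⊓_) (ℕP.m≥n⇒m⊓n≡n (ℕP.n≤1+n h))))

-- An entry stands for every word of u-cycle signs leading to it: it records the shape of
-- the word, its length capped at the horizon, the entries reached by one more sign, and
-- pairs (p₀ , p) such that a run along the word leads from p₀ to p.
record Entry (N : ℕ) : Set where
  constructor entry
  field
    shape       : Shape
    depth       : ℕ
    onPos onNeg : Fin N
    reached     : List (State × State)

open Entry

successor : ∀ {N} → Entry N → Sign → Fin N
successor e pos = onPos e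
successor e neg = onNeg e

_↦_ : State → List State → List (State × State)
p₀ ↦ ps = map (p₀ ,_) ps

infix 6 _↦_

module Certificate (bound horizon : ℕ) where

  Steps : Sign → State → State → Set
  Steps t p q = Transfer (Valid bound) p (proj₁ p - proj₁ q) × move t p (proj₁ p - proj₁ q) ≡ q

  steps? : ∀ t p q → Dec (Steps t p q)
  steps? t p q = (valid? bound R ×-dec valid? bound (proj₁ p - R) ×-dec valid? bound (proj₂ p + R)) ×-dec (move t p R ≟ₛ q)
    where
    R : ℤ
    R = proj₁ p - proj₁ q

  extend : ∀ {τ p₀ k p q} → Steps (τ k) p q → Run (Valid bound) τ p₀ k p → Run (Valid bound) τ p₀ (suc k) q
  extend {τ} {p₀} {k} (transfer , moves) r = subst (Run (Valid bound) τ p₀ (suc k)) moves (step r _ transfer)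

  Initial : ∀ {N} → Entry N → Set
  Initial e = shape e ≡ ⟨⟩ × depth e ≡ 0 × All (uncurry λ p₀ p → p ≡ p₀) (reached e)

  Follows : ∀ {N} → Entry N → Sign → Entry N → Set
  Follows e t e′ = shape e′ ≡ shapeStep (shape e) t × depth e′ ≡ suc (depth e) ⊓ horizon
    × All (λ q → Any (λ p → proj₁ p ≡ proj₁ q × Steps t (proj₂ p) (proj₂ q)) (reached e)) (reached e′)

  Closes : ∀ {N} → Entry N → Sign → Set
  Closes e ρ = depth e ≡ horizon → admissible (shape e) ρ ≡ true → Any (uncurry λ p₀ p → p ≡ close ρ p₀) (reached e)

  initial? : ∀ {N} (e : Entry N) → Dec (Initial e)
  initial? e = (shape e ≟ˢ ⟨⟩) ×-dec (depth e ℕ.≟ 0) ×-dec All.all? (λ { (p₀ , p) → p ≟ₛ p₀ }) (reached e)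

  follows? : ∀ {N} (e : Entry N) t e′ → Dec (Follows e t e′)
  follows? e t e′ = (shape e′ ≟ˢ shapeStep (shape e) t) ×-dec (depth e′ ℕ.≟ suc (depth e) ⊓ horizon)
    ×-dec All.all? (λ q → Any.any? (λ p → (proj₁ p ≟ₛ proj₁ q) ×-dec steps? t (proj₂ p) (proj₂ q)) (reached e)) (reached e′)

  closes? : ∀ {N} (e : Entry N) ρ → Dec (Closes e ρ)
  closes? e ρ = (depth e ℕ.≟ horizon) →-dec ((admissible (shape e) ρ Bool.≟ true) →-dec
    Any.any? (λ { (p₀ , p) → p ≟ₛ close ρ p₀ }) (reached e))

  module _ {N : ℕ} (table : Vec (Entry (suc N)) (suc N)) where

    private
      at : Fin (suc N) → Entry (suc N)
      at = lookup table

    EntryCorrect : Fin (suc N) → Set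
    EntryCorrect g = (Follows (at g) pos (at (onPos (at g))) × Follows (at g) neg (at (onNeg (at g))))
                   × Closes (at g) pos × Closes (at g) neg

    Correct : Set
    Correct = Initial (at zero) × (∀ g → EntryCorrect g)

    correct? : Dec Correct
    correct? = initial? (at zero) ×-dec all? (λ g →
      (follows? (at g) pos (at (onPos (at g))) ×-dec follows? (at g) neg (at (onNeg (at g))))
      ×-dec closes? (at g) pos ×-dec closes? (at g) neg)

  module Soundness {N : ℕ} (table : Vec (Entry (suc N)) (suc N)) (correct : Correct table) (τ : ℕ → Sign) where

    private
      at : Fin (suc N) → Entry (suc N)
      at = lookup table

      initial : Initial (at zero)
      initial = proj₁ correct

      follows : ∀ g t → Follows (at g) t (at (successor (at g) t))
      follows g pos = proj₁ (proj₁ (proj₂ correct g))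
      follows g neg = proj₂ (proj₁ (proj₂ correct g))

      closes : ∀ g ρ → Closes (at g) ρ
      closes g pos = proj₁ (proj₂ (proj₂ correct g))
      closes g neg = proj₂ (proj₂ (proj₂ correct g))

    entryAfter : ℕ → Fin (suc N)
    entryAfter zero    = zero
    entryAfter (suc k) = successor (at (entryAfter k)) (τ k)

    shape-after : ∀ k → shape (at (entryAfter k)) ≡ shapeAfter τ k
    shape-after zero    = proj₁ initial
    shape-after (suc k) = trans (proj₁ (follows (entryAfter k) (τ k))) (cong (λ s → shapeStep s (τ k)) (shape-after k))

    depth-after : ∀ k → depth (at (entryAfter k)) ≡ k ⊓ horizon
    depth-after zero    = proj₁ (proj₂ initial)
    depth-after (suc k) = begin
      depth (at (entryAfter (suc k)))           ≡⟨ proj₁ (proj₂ (follows (entryAfter k) (τ k))) ⟩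
      suc (depth (at (entryAfter k))) ⊓ horizon ≡⟨ cong (λ d → suc d ⊓ horizon) (depth-after k) ⟩
      suc (k ⊓ horizon) ⊓ horizon               ≡⟨ suc-⊓ k horizon ⟩
      suc k ⊓ horizon                           ∎
      where open ≡-Reasoning

    Reach : ℕ → State × State → Set
    Reach k = uncurry λ p₀ p → Run (Valid bound) τ p₀ k p

    reached-after : ∀ k → All (Reach k) (reached (at (entryAfter k)))
    reached-after zero    =
      All.map (λ {pr} p≡p₀ → subst (Run (Valid bound) τ (proj₁ pr) 0) (sym p≡p₀) start) (proj₂ (proj₂ initial))
    reached-after (suc k) = All.map (λ {q} → justify q) (proj₂ (proj₂ (follows (entryAfter k) (τ k))))
      where
      justify : ∀ q → Any (λ p → proj₁ p ≡ proj₁ q × Steps (τ k) (proj₂ p) (proj₂ q)) (reached (at (entryAfter k))) →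
                Reach (suc k) q
      justify q i with All.lookupAny (reached-after k) i
      ... | reach , same-start , steps = subst (λ p₀ → Run (Valid bound) τ p₀ (suc k) (proj₂ q)) same-start (extend steps reach)

    closing : ∀ {k} ρ → horizon ≤ k → admissible (shapeAfter τ k) ρ ≡ true → ∃[ p₀ ] Run (Valid bound) τ p₀ k (close ρ p₀)
    closing {k} ρ h≤k adm with All.lookupAny (reached-after k) (closes (entryAfter k) ρ at-horizon admissible-entry)
      where
      at-horizon : depth (at (entryAfter k)) ≡ horizon
      at-horizon = trans (depth-after k) (ℕP.m≥n⇒m⊓n≡n h≤k)
      admissible-entry : admissible (shape (at (entryAfter k))) ρ ≡ true
      admissible-entry = trans (cong (λ s → admissible s ρ) (shape-after k)) adm
    ... | reach , p≡close = _ , subst (Run (Valid bound) τ _ k) p≡close reach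

−4 −3 −2 −1 +1 +2 +3 +4 : ℤ
−4 = ℤ.-[1+ 3 ]
−3 = ℤ.-[1+ 2 ]
−2 = ℤ.-[1+ 1 ]
−1 = ℤ.-[1+ 0 ]
+1 = ℤ.+ 1
+2 = ℤ.+ 2
+3 = ℤ.+ 3
+4 = ℤ.+ 4

-- No single starting state serves every admissible word; these two together do.
A₀ B₀ : State
A₀ = −4 , +2
B₀ = −2 , +2

table : Vec (Entry 58) 58
table =
  entry ⟨⟩ 0 (# 1) (# 2)
      (A₀ ↦ (A₀ ∷ [])
      ++ B₀ ↦ (B₀ ∷ [])) ∷
  entry ⟨P⟩ 1 (# 3) (# 4)
      (A₀ ↦ ((−3 , +1) ∷ (−1 , −1) ∷ [])
      ++ B₀ ↦ ((−1 , +1) ∷ (+2 , −2) ∷ [])) ∷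
  entry ⟨N⟩ 1 (# 5) (# 6)
      (A₀ ↦ ((−3 , −1) ∷ (−1 , +1) ∷ [])
      ++ B₀ ↦ ((+2 , +2) ∷ [])) ∷
  entry ⟨P⟩ 2 (# 7) (# 8)
      (A₀ ↦ ((−3 , +1) ∷ (−1 , −1) ∷ [])
      ++ B₀ ↦ ((−1 , +1) ∷ (+2 , −2) ∷ [])) ∷
  entry ⟨PN⟩ 2 (# 9) (# 10)
      (A₀ ↦ ((−4 , −2) ∷ (−3 , −1) ∷ (−1 , +1) ∷ (+1 , +3) ∷ (+2 , +4) ∷ [])) ∷
  entry ⟨NP⟩ 2 (# 11) (# 12)
      (A₀ ↦ ((−4 , +4) ∷ (−2 , −2) ∷ (−1 , −3) ∷ (+2 , −2) ∷ (+3 , −3) ∷ [])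
      ++ B₀ ↦ ((+1 , +3) ∷ [])) ∷
  entry ⟨NN⟩ 2 (# 13) (# 14)
      (A₀ ↦ ((−3 , −3) ∷ (−2 , −2) ∷ (−2 , +2) ∷ (−1 , +3) ∷ (+1 , +1) ∷ (+2 , +2) ∷ (+3 , +3) ∷ [])) ∷
  entry ⟨P⟩ 3 (# 15) (# 16)
      (A₀ ↦ ((−3 , +1) ∷ (−1 , −1) ∷ [])
      ++ B₀ ↦ ((−1 , +1) ∷ (+2 , −2) ∷ [])) ∷
  entry ⟨PN⟩ 3 (# 17) (# 18)
      (A₀ ↦ ((−4 , −2) ∷ (−3 , −1) ∷ (−1 , +1) ∷ (+1 , +3) ∷ (+2 , +4) ∷ [])) ∷
  entry ⟨PNP⟩ 3 (# 19) (# 20)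
      (A₀ ↦ ((−4 , +4) ∷ (−2 , −4) ∷ (−2 , −2) ∷ (−1 , −3) ∷ (+2 , −2) ∷ (+2 , +2) ∷ (+3 , −3) ∷
        (+3 , +1) ∷ (+3 , +3) ∷ (+4 , +2) ∷ [])) ∷
  entry ⟨NN⟩ 3 (# 21) (# 22)
      (A₀ ↦ ((−3 , −3) ∷ (−2 , −2) ∷ (−2 , +2) ∷ (+1 , +1) ∷ (+2 , −2) ∷ (+2 , +2) ∷ (+3 , −1) ∷
        (+3 , +3) ∷ [])) ∷
  entry ⟨NP⟩ 3 (# 23) (# 24)
      (A₀ ↦ ((−3 , −1) ∷ (−2 , −2) ∷ (−1 , +1) ∷ (+2 , −2) ∷ [])
      ++ B₀ ↦ ((+2 , +2) ∷ (+3 , +1) ∷ [])) ∷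
  entry ⟨NPN⟩ 3 (# 25) (# 26)
      (A₀ ↦ ((−3 , −3) ∷ (−3 , +1) ∷ (−2 , −2) ∷ (−2 , +2) ∷ (−1 , −1) ∷ (−1 , +3) ∷ (+1 , +1) ∷
        (+2 , +2) ∷ (+3 , +3) ∷ [])) ∷
  entry ⟨NNP⟩ 3 (# 27) (# 28)
      (A₀ ↦ ((−3 , −1) ∷ (−2 , −4) ∷ (−1 , +1) ∷ (+1 , +1) ∷ (+1 , +3) ∷ (+2 , −2) ∷ (+2 , +4) ∷
        (+3 , −1) ∷ (+3 , +1) ∷ [])) ∷
  entry ⟨NNN⟩ 3 (# 29) (# 30)
      (A₀ ↦ ((−3 , +1) ∷ (−2 , −4) ∷ (−1 , −3) ∷ (+1 , −1) ∷ (+1 , +1) ∷ (+2 , +2) ∷ (+3 , +1) ∷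
        (+4 , +2) ∷ [])) ∷
  entry ⟨P⟩ 4 (# 31) (# 32)
      (A₀ ↦ ((−3 , +1) ∷ (−1 , −1) ∷ [])
      ++ B₀ ↦ ((−1 , +1) ∷ (+2 , −2) ∷ [])) ∷
  entry ⟨PN⟩ 4 (# 33) (# 34)
      (A₀ ↦ ((−4 , −2) ∷ (−3 , −1) ∷ (−1 , +1) ∷ (+1 , +3) ∷ (+2 , +4) ∷ [])) ∷
  entry ⟨PNP⟩ 4 (# 35) (# 36)
      (A₀ ↦ ((−4 , +4) ∷ (−2 , −4) ∷ (−2 , −2) ∷ (−1 , −3) ∷ (+2 , −2) ∷ (+2 , +2) ∷ (+3 , −3) ∷
        (+3 , +1) ∷ (+3 , +3) ∷ (+4 , +2) ∷ [])) ∷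
  entry ⟨NN⟩ 4 (# 37) (# 38)
      (A₀ ↦ ((−3 , −3) ∷ (−2 , −2) ∷ (−2 , +2) ∷ (+1 , +1) ∷ (+2 , −2) ∷ (+2 , +2) ∷ (+3 , −1) ∷
        (+3 , +3) ∷ [])) ∷
  entry ⟨PNP⟩ 4 (# 35) (# 36)
      (A₀ ↦ ((−4 , −2) ∷ (−3 , −3) ∷ (−3 , +3) ∷ (−2 , −2) ∷ (−1 , −3) ∷ (−1 , +1) ∷ (+2 , +2) ∷
        (+3 , +1) ∷ (+3 , +3) ∷ (+4 , +2) ∷ [])) ∷
  entry ⟨PNPN⟩ 4 (# 39) (# 40)
      (A₀ ↦ ((−3 , −3) ∷ (−2 , −2) ∷ (−2 , +2) ∷ (−1 , −1) ∷ (−1 , +3) ∷ (+1 , −3) ∷ (+2 , −2) ∷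
        (+2 , +2) ∷ (+3 , −1) ∷ (+3 , +3) ∷ [])) ∷
  entry ⟨NNP⟩ 4 (# 41) (# 42)
      (A₀ ↦ ((−3 , −1) ∷ (−3 , +3) ∷ (−2 , −4) ∷ (−1 , +1) ∷ (−1 , +3) ∷ (+1 , +3) ∷ (+2 , +4) ∷
        (+3 , −1) ∷ [])) ∷
  entry ⟨NNN⟩ 4 (# 43) (# 44)
      (A₀ ↦ ((−2 , −4) ∷ (−2 , −2) ∷ (−1 , −3) ∷ (−1 , −1) ∷ (−1 , +3) ∷ (+1 , −3) ∷ (+1 , −1) ∷
        (+2 , +2) ∷ (+3 , −1) ∷ (+3 , +1) ∷ (+3 , +3) ∷ (+4 , +2) ∷ [])) ∷
  entry ⟨NP⟩ 4 (# 45) (# 46)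
      (A₀ ↦ ((−3 , −1) ∷ (−2 , −2) ∷ (−1 , +1) ∷ (+2 , −2) ∷ [])
      ++ B₀ ↦ ((+2 , +2) ∷ (+3 , +1) ∷ [])) ∷
  entry ⟨NPN⟩ 4 (# 47) (# 48)
      (A₀ ↦ ((−3 , −3) ∷ (−3 , +1) ∷ (−2 , −2) ∷ (−2 , +2) ∷ (−1 , −1) ∷ (−1 , +3) ∷ (+1 , +1) ∷
        (+2 , +2) ∷ (+3 , +3) ∷ [])) ∷
  entry ⟨NPNP⟩ 4 (# 49) (# 50)
      (A₀ ↦ ((−3 , −1) ∷ (−3 , +3) ∷ (−2 , −4) ∷ (−1 , −1) ∷ (−1 , +1) ∷ (−1 , +3) ∷ (+1 , −3) ∷
        (+1 , +3) ∷ (+2 , +4) ∷ (+3 , −1) ∷ [])) ∷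
  entry ⟨NNN⟩ 4 (# 51) (# 52)
      (A₀ ↦ ((−4 , −2) ∷ (−3 , −3) ∷ (−3 , −1) ∷ (−1 , −1) ∷ (−1 , +3) ∷ (+1 , −3) ∷ (+1 , −1) ∷
        (+2 , +2) ∷ (+2 , +4) ∷ (+3 , −1) ∷ (+3 , +1) ∷ [])) ∷
  entry ⟨NNP⟩ 4 (# 41) (# 42)
      (A₀ ↦ ((−4 , −2) ∷ (−3 , −3) ∷ (−3 , +3) ∷ (−2 , −2) ∷ (−1 , −3) ∷ (−1 , +1) ∷ (−1 , +3) ∷
        (+2 , +2) ∷ (+3 , −1) ∷ (+3 , +1) ∷ (+3 , +3) ∷ (+4 , +2) ∷ [])) ∷
  entry ⟨NNN⟩ 4 (# 53) (# 50)
      (A₀ ↦ ((−2 , −4) ∷ (−2 , −2) ∷ (−1 , −3) ∷ (−1 , −1) ∷ (−1 , +3) ∷ (+1 , −3) ∷ (+1 , −1) ∷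
        (+2 , +2) ∷ (+3 , −1) ∷ (+3 , +1) ∷ (+3 , +3) ∷ (+4 , +2) ∷ [])) ∷
  entry ⟨NNN⟩ 4 (# 54) (# 55)
      (A₀ ↦ ((−4 , −2) ∷ (−3 , −3) ∷ (−3 , −1) ∷ (−3 , +3) ∷ (−1 , −1) ∷ (−1 , +1) ∷ (−1 , +3) ∷
        (+1 , −3) ∷ (+2 , +2) ∷ (+2 , +4) ∷ (+3 , −1) ∷ (+3 , +1) ∷ [])) ∷
  entry ⟨NNN⟩ 4 (# 56) (# 57)
      (A₀ ↦ ((−4 , −2) ∷ (−3 , −3) ∷ (−3 , +3) ∷ (−2 , −2) ∷ (−1 , −3) ∷ (−1 , −1) ∷ (−1 , +1) ∷
        (+1 , −3) ∷ (+2 , +2) ∷ (+3 , −1) ∷ (+3 , +1) ∷ (+3 , +3) ∷ (+4 , +2) ∷ [])) ∷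
  entry ⟨P⟩ 5 (# 31) (# 32)
      (A₀ ↦ ((−4 , +2) ∷ (−1 , −1) ∷ [])
      ++ B₀ ↦ ((−1 , +1) ∷ (+2 , −2) ∷ [])) ∷
  entry ⟨PN⟩ 5 (# 33) (# 34)
      (A₀ ↦ ((−4 , −2) ∷ (−3 , −1) ∷ (−1 , +1) ∷ (+1 , +3) ∷ (+2 , +4) ∷ [])
      ++ B₀ ↦ ((+2 , +2) ∷ [])) ∷
  entry ⟨PNP⟩ 5 (# 35) (# 36)
      (A₀ ↦ ((−4 , +4) ∷ (−2 , −4) ∷ (−2 , −2) ∷ (−1 , −3) ∷ (+2 , −2) ∷ (+2 , +2) ∷ (+3 , −3) ∷
        (+3 , +1) ∷ (+3 , +3) ∷ (+4 , +2) ∷ [])) ∷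
  entry ⟨NN⟩ 5 (# 37) (# 38)
      (A₀ ↦ ((−3 , −3) ∷ (−2 , −2) ∷ (−2 , +2) ∷ (+1 , +1) ∷ (+2 , −2) ∷ (+2 , +2) ∷ (+3 , −1) ∷
        (+3 , +3) ∷ [])) ∷
  entry ⟨PNP⟩ 5 (# 35) (# 36)
      (A₀ ↦ ((−4 , −2) ∷ (−3 , −3) ∷ (−3 , +3) ∷ (−2 , −2) ∷ (−1 , −3) ∷ (−1 , +1) ∷ (+2 , +2) ∷
        (+3 , +1) ∷ (+3 , +3) ∷ (+4 , +2) ∷ [])) ∷
  entry ⟨PNPN⟩ 5 (# 39) (# 40)
      (A₀ ↦ ((−4 , +2) ∷ (−3 , −3) ∷ (−2 , −2) ∷ (−2 , +2) ∷ (−1 , −1) ∷ (−1 , +3) ∷ (+2 , −2) ∷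
        (+2 , +2) ∷ (+3 , −1) ∷ (+3 , +3) ∷ [])) ∷
  entry ⟨NNP⟩ 5 (# 41) (# 42)
      (A₀ ↦ ((−3 , −1) ∷ (−3 , +3) ∷ (−2 , −4) ∷ (−1 , +1) ∷ (−1 , +3) ∷ (+1 , +3) ∷ (+2 , +4) ∷
        (+3 , −1) ∷ (+4 , +2) ∷ [])) ∷
  entry ⟨NNN⟩ 5 (# 43) (# 44)
      (A₀ ↦ ((−4 , +2) ∷ (−2 , −4) ∷ (−2 , −2) ∷ (−1 , −3) ∷ (−1 , −1) ∷ (−1 , +3) ∷ (+1 , −1) ∷
        (+2 , +2) ∷ (+3 , −1) ∷ (+3 , +1) ∷ (+3 , +3) ∷ (+4 , +2) ∷ [])) ∷
  entry ⟨NPNP⟩ 5 (# 49) (# 50)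
      (A₀ ↦ ((−4 , +2) ∷ (−3 , −1) ∷ (−3 , +3) ∷ (−2 , −4) ∷ (−1 , −1) ∷ (−1 , +1) ∷ (−1 , +3) ∷
        (+1 , +3) ∷ (+2 , +4) ∷ (+3 , −1) ∷ (+4 , +2) ∷ [])) ∷
  entry ⟨NNN⟩ 5 (# 53) (# 50)
      (A₀ ↦ ((−4 , −2) ∷ (−4 , +2) ∷ (−3 , −3) ∷ (−2 , −2) ∷ (−1 , −3) ∷ (−1 , −1) ∷ (−1 , +3) ∷
        (+1 , −1) ∷ (+2 , +2) ∷ (+3 , −1) ∷ (+3 , +1) ∷ (+3 , +3) ∷ (+4 , +2) ∷ [])) ∷
  entry ⟨NNP⟩ 5 (# 41) (# 42)
      (A₀ ↦ ((−4 , −2) ∷ (−3 , −3) ∷ (−3 , +3) ∷ (−2 , −2) ∷ (−1 , −3) ∷ (−1 , +1) ∷ (−1 , +3) ∷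
        (+2 , +2) ∷ (+3 , −1) ∷ (+3 , +1) ∷ (+3 , +3) ∷ (+4 , +2) ∷ [])) ∷
  entry ⟨NNN⟩ 5 (# 53) (# 50)
      (A₀ ↦ ((−4 , +2) ∷ (−2 , −4) ∷ (−2 , −2) ∷ (−1 , −3) ∷ (−1 , −1) ∷ (−1 , +3) ∷ (+1 , −1) ∷
        (+2 , +2) ∷ (+3 , −1) ∷ (+3 , +1) ∷ (+3 , +3) ∷ (+4 , +2) ∷ [])) ∷
  entry ⟨NNN⟩ 5 (# 53) (# 50)
      (A₀ ↦ ((−4 , −2) ∷ (−4 , +2) ∷ (−3 , −3) ∷ (−3 , +3) ∷ (−2 , −2) ∷ (−1 , −3) ∷ (−1 , −1) ∷
        (−1 , +1) ∷ (−1 , +3) ∷ (+2 , +2) ∷ (+3 , −1) ∷ (+3 , +1) ∷ (+3 , +3) ∷ (+4 , +2) ∷ [])) ∷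
  entry ⟨NNN⟩ 5 (# 53) (# 50)
      (A₀ ↦ ((−4 , −2) ∷ (−4 , +2) ∷ (−3 , −3) ∷ (−3 , +3) ∷ (−2 , −2) ∷ (−1 , −3) ∷ (−1 , −1) ∷
        (−1 , +1) ∷ (−1 , +3) ∷ (+2 , +2) ∷ (+3 , −1) ∷ (+3 , +1) ∷ (+3 , +3) ∷ (+4 , +2) ∷ [])) ∷
  entry ⟨NP⟩ 5 (# 45) (# 46)
      (A₀ ↦ ((−3 , −1) ∷ (−2 , −2) ∷ (−1 , +1) ∷ (+2 , −2) ∷ [])
      ++ B₀ ↦ ((+2 , +2) ∷ (+3 , +1) ∷ [])) ∷
  entry ⟨NPN⟩ 5 (# 47) (# 48)
      (A₀ ↦ ((−3 , −3) ∷ (−3 , +1) ∷ (−2 , −2) ∷ (−2 , +2) ∷ (−1 , −1) ∷ (−1 , +3) ∷ (+1 , +1) ∷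
        (+2 , +2) ∷ (+3 , +3) ∷ [])) ∷
  entry ⟨NPNP⟩ 5 (# 49) (# 50)
      (A₀ ↦ ((−4 , +2) ∷ (−3 , −1) ∷ (−3 , +3) ∷ (−2 , −4) ∷ (−1 , −1) ∷ (−1 , +1) ∷ (−1 , +3) ∷
        (+1 , +3) ∷ (+2 , +4) ∷ (+3 , −1) ∷ (+4 , +2) ∷ [])) ∷
  entry ⟨NNN⟩ 5 (# 51) (# 52)
      (A₀ ↦ ((−4 , −2) ∷ (−4 , +2) ∷ (−3 , −3) ∷ (−3 , −1) ∷ (−1 , −1) ∷ (−1 , +3) ∷ (+1 , −1) ∷
        (+2 , +2) ∷ (+2 , +4) ∷ (+3 , −1) ∷ (+3 , +1) ∷ (+4 , +2) ∷ [])) ∷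
  entry ⟨NPNP⟩ 5 (# 49) (# 50)
      (A₀ ↦ ((−4 , −2) ∷ (−4 , +2) ∷ (−3 , −3) ∷ (−3 , +3) ∷ (−2 , −2) ∷ (−1 , −3) ∷ (−1 , −1) ∷
        (−1 , +1) ∷ (−1 , +3) ∷ (+2 , +2) ∷ (+3 , −1) ∷ (+3 , +1) ∷ (+3 , +3) ∷ (+4 , +2) ∷ [])) ∷
  entry ⟨NNN⟩ 5 (# 53) (# 50)
      (A₀ ↦ ((−4 , −2) ∷ (−4 , +2) ∷ (−3 , −3) ∷ (−3 , +3) ∷ (−2 , −2) ∷ (−1 , −3) ∷ (−1 , −1) ∷
        (−1 , +1) ∷ (−1 , +3) ∷ (+2 , +2) ∷ (+3 , −1) ∷ (+3 , +1) ∷ (+3 , +3) ∷ (+4 , +2) ∷ [])) ∷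
  entry ⟨NNN⟩ 5 (# 53) (# 50)
      (A₀ ↦ ((−4 , −2) ∷ (−4 , +2) ∷ (−3 , −3) ∷ (−3 , +3) ∷ (−2 , −2) ∷ (−1 , −3) ∷ (−1 , −1) ∷
        (−1 , +1) ∷ (−1 , +3) ∷ (+2 , +2) ∷ (+3 , −1) ∷ (+3 , +1) ∷ (+3 , +3) ∷ (+4 , +2) ∷ [])) ∷
  entry ⟨NNN⟩ 5 (# 53) (# 50)
      (A₀ ↦ ((−4 , −2) ∷ (−4 , +2) ∷ (−3 , −3) ∷ (−3 , +3) ∷ (−2 , −2) ∷ (−1 , −3) ∷ (−1 , −1) ∷
        (−1 , +1) ∷ (−1 , +3) ∷ (+2 , +2) ∷ (+3 , −1) ∷ (+3 , +1) ∷ (+3 , +3) ∷ (+4 , +2) ∷ [])) ∷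
  entry ⟨NNN⟩ 5 (# 53) (# 50)
      (A₀ ↦ ((−4 , −2) ∷ (−4 , +2) ∷ (−3 , −3) ∷ (−3 , +3) ∷ (−2 , −2) ∷ (−1 , −3) ∷ (−1 , −1) ∷
        (−1 , +1) ∷ (−1 , +3) ∷ (+2 , +2) ∷ (+3 , −1) ∷ (+3 , +1) ∷ (+3 , +3) ∷ (+4 , +2) ∷ [])) ∷
  entry ⟨NNN⟩ 5 (# 54) (# 55)
      (A₀ ↦ ((−4 , −2) ∷ (−4 , +2) ∷ (−3 , −3) ∷ (−3 , +3) ∷ (−2 , −2) ∷ (−1 , −3) ∷ (−1 , −1) ∷
        (−1 , +1) ∷ (−1 , +3) ∷ (+2 , +2) ∷ (+3 , −1) ∷ (+3 , +1) ∷ (+3 , +3) ∷ (+4 , +2) ∷ [])) ∷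
  entry ⟨NNN⟩ 5 (# 53) (# 50)
      (A₀ ↦ ((−4 , −2) ∷ (−4 , +2) ∷ (−3 , −3) ∷ (−3 , +3) ∷ (−2 , −2) ∷ (−1 , −3) ∷ (−1 , −1) ∷
        (−1 , +1) ∷ (−1 , +3) ∷ (+2 , +2) ∷ (+3 , −1) ∷ (+3 , +1) ∷ (+3 , +3) ∷ (+4 , +2) ∷ [])) ∷
  entry ⟨NNN⟩ 5 (# 53) (# 50)
      (A₀ ↦ ((−4 , −2) ∷ (−4 , +2) ∷ (−3 , −3) ∷ (−3 , +3) ∷ (−2 , −2) ∷ (−1 , −3) ∷ (−1 , −1) ∷
        (−1 , +1) ∷ (+1 , +1) ∷ (+2 , +2) ∷ (+3 , +1) ∷ (+3 , +3) ∷ (+4 , +2) ∷ [])) ∷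
  entry ⟨NNN⟩ 5 (# 53) (# 50)
      (A₀ ↦ ((−4 , −2) ∷ (−4 , +2) ∷ (−3 , −3) ∷ (−3 , +3) ∷ (−2 , −2) ∷ (−1 , −3) ∷ (−1 , −1) ∷
        (−1 , +1) ∷ (−1 , +3) ∷ (+1 , +3) ∷ (+3 , −1) ∷ (+3 , +3) ∷ (+4 , +2) ∷ [])) ∷
  []

table-correct : Certificate.Correct 5 5 table
table-correct = from-yes (Certificate.correct? 5 5 table)

mainTheorem4 : (n : ℕ) → 5 ≤ n → (σ : Signature n) → FlowAdmissible σ → NZFlow σ 5
mainTheorem4 (suc m) 5≤n σ (k , F) = NZFlow-cong (switch-involutive σ) (switchFlow flow₅)
  where
  open Normalisation σ using (normaliser; switch-normal)
  open Switching normaliser using (switch; switchFlow; switch-involutive)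
  σ′ : Signature (suc m)
  σ′ = switch σ
  admissible-σ′ : admissible (shapeAfter (cycleWord σ′) (suc m)) (lastSign σ′) ≡ true
  admissible-σ′ = closedRun⇒admissible {σ = σ′} (flow⇒closedRun switch-normal (switchFlow F))
  run₅ : ClosedRun σ′ 5
  run₅ = Certificate.Soundness.closing 5 5 table table-correct (cycleWord σ′) (lastSign σ′) 5≤n admissible-σ′
  flow₅ : NZFlow σ′ 5
  flow₅ = closedRun⇒flow switch-normal run₅
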